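{- Let $(p_n(x))_{n\ge-1}$ and $(q_n(x))_{n\ge-1}$ be the polynomials defined by $p_{ -1}(x)=0$, $q_{ -1}(x)=1$ and, for $k\ge -1$, $$p_{k+1}(x)=2(kx+1)p_k(x)+2x(1-x)p_k'(x)+q_k(x),\qquad q_{k+1}(x)=\bigl(2(k+1)x+1\bigr)q_k(x)+2x(1-x)q_k'(x).$$ For $n\ge 0$ let $F_n(x,y)$ be the bivariate Eulerian polynomial: $F_0(x,y)=1$ and $F_n(x,y)=\sum_{\pi\in\mathfrak S_n}x^{\mathrm{exc}(\pi)}y^{\mathrm{cyc}(\pi)}$ for $n>0$. Then for every $n\ge0$, $$p_n(x)=2^n\sum_{k=0}^n\binom{n+1}{k}F_{n-k}(x,1/2)\,F_k(x,1/2).$$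
   Context: $\mathfrak S_n$ is the set of permutations $\pi=\pi_1\cdots\pi_n$ of $\{1,\dots,n\}$; $\mathrm{exc}(\pi)=|\{i:\pi_i>i\}|$ is the number of excedances and $\mathrm{cyc}(\pi)$ is the number of cycles in the disjoint cycle decomposition of $\pi$. -}

module Defs where

open import Data.Nat using (ℕ; zero; suc; _∸_; _<ᵇ_; _≤ᵇ_)
open import Data.Nat.Combinatorics using (_C_)
open import Data.Bool using (Bool; true; false; if_then_else_; _∧_; not)
open import Data.Fin using (Fin; toℕ)
open import Data.Fin.Properties using (_≟_)
open import Data.List using (List; []; _∷_; concatMap; map; filter; allFin; length; foldr; upTo)
open import Data.Vec using (Vec; lookup; toList)
import Data.Vec as V
open import Relation.Nullary.Decidable using (⌊_⌋)
open import Data.Integer using (ℤ; +_)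
open import Data.Rational using (ℚ; 0ℚ; 1ℚ; ½; _+_; _*_; _-_; _/_)

-- Univariate polynomials over ℚ, represented by their coefficient
-- sequences  (coefficient of x^k).  Only finitely supported sequences
-- arise below.

Poly : Set
Poly = ℕ → ℚ

ℕ→ℚ : ℕ → ℚ
ℕ→ℚ n = + n / 1

Σ≤ : ℕ → (ℕ → ℚ) → ℚ
Σ≤ zero    f = f 0
Σ≤ (suc k) f = Σ≤ k f + f (suc k)

0P : Poly
0P _ = 0ℚ

1P : Poly
1P zero    = 1ℚ
1P (suc _) = 0ℚ

constP : ℚ → Poly
constP c zero    = c
constP c (suc _) = 0ℚ

xP : Poly
xP 1 = 1ℚ
xP _ = 0ℚ

_⊕_ : Poly → Poly → Poly
(p ⊕ q) k = p k + q k
infixl 6 _⊕_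

_⊖_ : Poly → Poly → Poly
(p ⊖ q) k = p k - q k
infixl 6 _⊖_

_⊗_ : Poly → Poly → Poly
(p ⊗ q) k = Σ≤ k (λ i → p i * q (k ∸ i))
infixl 7 _⊗_

deriv : Poly → Poly
deriv p k = ℕ→ℚ (suc k) * p (suc k)

-- The sequences p_n, q_n for n ≥ -1, shifted by one:
--   pp m = p_{m-1},  qq m = q_{m-1}.

2P : Poly
2P = constP (ℕ→ℚ 2)

twoX1mX : Poly
twoX1mX = 2P ⊗ xP ⊗ (1P ⊖ xP)

qq : ℕ → Poly
qq zero    = 1P
qq (suc m) = ((2P ⊗ constP (ℕ→ℚ m) ⊗ xP ⊕ 1P) ⊗ qq m)      -- here k+1 = m
             ⊕ (twoX1mX ⊗ deriv (qq m))

pp : ℕ → Poly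
pp zero    = 0P
pp (suc m) = (2P ⊗ (constP (ℕ→ℚ m - 1ℚ) ⊗ xP ⊕ 1P) ⊗ pp m)  -- here k = m - 1
             ⊕ (twoX1mX ⊗ deriv (pp m))
             ⊕ qq m

p : ℕ → Poly
p n = pp (suc n)

q : ℕ → Poly
q n = qq (suc n)

-- Permutations of {1..n}, realised on Fin n (i ↦ i+1 shift is harmless
-- for excedances and cycles).  A permutation is a word π₁⋯πₙ given as
-- a vector; 𝔖 n is the list of all injective words of length n over Fin n,
-- i.e. exactly the permutations, each listed once.

words : (n k : ℕ) → List (Vec (Fin n) k)
words n zero    = V.[] ∷ []
words n (suc k) = concatMap (λ a → map (a V.∷_) (words n k)) (allFin n)

eqᵇ : ∀ {n} → Fin n → Fin n → Bool
eqᵇ a b = ⌊ a ≟ b ⌋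

allᵇ : ∀ {A : Set} → (A → Bool) → List A → Bool
allᵇ f = foldr (λ a r → f a ∧ r) true

countᵇ : ∀ {A : Set} → (A → Bool) → List A → ℕ
countᵇ f []       = 0
countᵇ f (a ∷ as) = if f a then suc (countᵇ f as) else countᵇ f as

injᵇ : ∀ {n} → Vec (Fin n) n → Bool
injᵇ {n} π = allᵇ (λ i → allᵇ (λ j → eqᵇ i j ∨' not (eqᵇ (lookup π i) (lookup π j)))
                             (allFin n)) (allFin n)
  where
  _∨'_ : Bool → Bool → Bool
  true  ∨' _ = true
  false ∨' b = b

𝔖 : (n : ℕ) → List (Vec (Fin n) n)
𝔖 n = filter (λ π → Data.Bool._≟_ (injᵇ π) true) (words n n)
  where import Data.Bool

exc : ∀ {n} → Vec (Fin n) n → ℕ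
exc {n} π = countᵇ (λ i → toℕ i <ᵇ toℕ (lookup π i)) (allFin n)

iter : ∀ {n} → Vec (Fin n) n → ℕ → Fin n → Fin n
iter π zero    i = i
iter π (suc t) i = lookup π (iter π t i)

-- cyc(π) = number of cycles = number of cycle minima, i.e. of i with
-- i ≤ π^t(i) for all 1 ≤ t ≤ n (each cycle has exactly one minimum)
cyc : ∀ {n} → Vec (Fin n) n → ℕ
cyc {n} π = countᵇ (λ i → allᵇ (λ t → toℕ i ≤ᵇ toℕ (iter π (suc t) i)) (upTo n))
                   (allFin n)

_^ℚ_ : ℚ → ℕ → ℚ
a ^ℚ zero  = 1ℚ
a ^ℚ suc k = a * (a ^ℚ k)

sumℚ : List ℚ → ℚ
sumℚ = foldr _+_ 0ℚ

-- F_n(x, y) evaluated at y = c, as a polynomial in x: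
-- coefficient of x^j is  Σ_{π ∈ 𝔖_n, exc π = j} c^{cyc π};  F_0 = 1.
Fat : ℕ → ℚ → Poly
Fat zero    c = 1P
Fat (suc n) c j = sumℚ (map (λ π → if ⌊ Data.Nat._≟_ (exc π) j ⌋ then c ^ℚ cyc π else 0ℚ)
                            (𝔖 (suc n)))
  where import Data.Nat

ΣP : ℕ → (ℕ → Poly) → Poly
ΣP n f j = Σ≤ n (λ k → f k j)

rhs : ℕ → Poly
rhs n = constP (ℕ→ℚ 2 ^ℚ n) ⊗
        ΣP n (λ k → constP (ℕ→ℚ (suc n C k)) ⊗ Fat (n ∸ k) ½ ⊗ Fat k ½)

-- The q's satisfy q_m = L_m q_{m−1} for the operator L_m f = (2mx + 1) f + 2x(1 − x) f′, and
-- p_{n+1} = L_n p_n + p_n + q_n. Inserting the new maximum into a permutation of [n], either as a new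
-- fixed point or right after some a on the cycle of a, raises cyc by one or raises exc by one exactly
-- when a is not an excedance; summing over all insertions gives F_{n+1} = (y + n x) F_n + x(1 − x) F_n′,
-- so 2^m F_m(x, ½) satisfies the recurrence of q_{m−1}. Finally L obeys the Leibniz rule
-- L_{a+b}(f g) = (L_a f) g + f (L_b g) − f g; applied to q_{n−i−1} q_{i−1} and combined with Pascal's rule
-- it gives p_n = Σ_i C(n+1, i) q_{n−i−1} q_{i−1} by induction on n.

module Submission where

open import Defs
open import Data.Nat using (ℕ)
open import Relation.Binary.PropositionalEquality using (_≡_)

open import Data.Bool using (Bool; true; false; if_then_else_; not; _∧_)
open import Data.Bool.Properties as BoolP using (T-≡; ⇔→≡)
open import Data.Empty using (⊥-elim)
open import Data.Fin as Fin using (Fin; toℕ; fromℕ; inject₁)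
import Data.Fin.Properties as FinP
open import Data.Fin.Relation.Unary.Top using (view; ‵fromℕ; ‵inject₁; view-fromℕ; view-inject₁)
import Data.Integer as ℤ
import Data.Integer.Properties as ℤP
open import Data.List as L using (List; []; _∷_; applyUpTo; upTo)
import Data.List.Properties as LP
open import Data.List.Membership.Propositional using (_∈_)
open import Data.List.Membership.Propositional.Properties
  using (∈-filter⁺; ∈-filter⁻; ∈-allFin; ∈-cartesianProductWith⁺; ∈-cartesianProductWith⁻)
open import Data.List.Membership.Propositional.Properties.WithK using (unique∧set⇒bag)
open import Data.List.Relation.Binary.BagAndSetEquality using (∼bag⇒↭)
open import Data.List.Relation.Binary.Permutation.Propositional using (_↭_; ↭⇒↭ₛ)
import Data.List.Relation.Binary.Permutation.Propositional.Properties as PermP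
open import Data.List.Relation.Binary.Permutation.Setoid.Properties using (foldr-commMonoid)
import Data.List.Relation.Unary.All as All
open import Data.List.Relation.Unary.AllPairs using ([]; _∷_)
open import Data.List.Relation.Unary.Any using (here)
open import Data.List.Relation.Unary.Unique.Propositional using (Unique)
import Data.List.Relation.Unary.Unique.Propositional.Properties as UniqueP
open import Data.Nat as ℕ using (zero; suc; _∸_; _≤_; _<_; z≤n; _<ᵇ_; _≤ᵇ_)
open import Data.Nat.Combinatorics using (_C_; nCk+nC[k+1]≡[n+1]C[k+1]; nCn≡1)
import Data.Nat.Properties as ℕP
open import Data.Product using (∃; _×_; _,_; proj₂)
open import Data.Rational using (ℚ; 0ℚ; 1ℚ; ½; _+_; _*_; _-_)
import Data.Rational.Properties as ℚP
open import Data.Rational.Solver using (module +-*-Solver)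
import Data.Rational.Unnormalised as ℚᵘ
import Data.Rational.Unnormalised.Properties as ℚᵘP
open import Data.Sum using (_⊎_; inj₁; inj₂; [_,_]′)
open import Data.Vec as V using (Vec; lookup)
import Data.Vec.Properties as VP
open import Function using (_∘_; case_of_)
open import Function.Bundles using (Equivalence; mk⇔)
open import Function.Definitions using (Injective)
open import Relation.Binary.PropositionalEquality
  using (refl; sym; trans; cong; cong₂; subst; subst₂; setoid; _≗_; _≢_; module ≡-Reasoning)
open import Relation.Nullary using (yes; no)
open import Relation.Nullary.Decidable using (⌊_⌋)

open import Algebra.Properties.Monoid.Sum ℚP.+-0-monoid using (sum; sum-init-last; sum-cong-≗)
import Algebra.Properties.Monoid.Sum ℕP.+-0-monoid as ℕΣ
open +-*-Solver using (solve; _:+_; _:*_; _:-_; _:=_; con)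

two : ℚ
two = ℕ→ℚ 2

ℕ→ℚ-+ : ∀ m n → ℕ→ℚ (m ℕ.+ n) ≡ ℕ→ℚ m + ℕ→ℚ n
ℕ→ℚ-+ m n = ℚP.toℚᵘ-injective (begin
    toℚᵘ (ℕ→ℚ (m ℕ.+ n))          ≈⟨ toℚᵘ-ℕ→ℚ (m ℕ.+ n) ⟩
    ℕ→ℚᵘ (m ℕ.+ n)                 ≈⟨ ℚᵘ.*≡* integral ⟩
    ℕ→ℚᵘ m ℚᵘ.+ ℕ→ℚᵘ n            ≈⟨ ℚᵘP.+-cong (toℚᵘ-ℕ→ℚ m) (toℚᵘ-ℕ→ℚ n) ⟨
    toℚᵘ (ℕ→ℚ m) ℚᵘ.+ toℚᵘ (ℕ→ℚ n) ≈⟨ ℚP.toℚᵘ-homo-+ (ℕ→ℚ m) (ℕ→ℚ n) ⟨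
    toℚᵘ (ℕ→ℚ m + ℕ→ℚ n)          ∎)
  where
  open import Data.Rational using (toℚᵘ)
  open import Relation.Binary.Reasoning.Setoid ℚᵘP.≃-setoid
  ℕ→ℚᵘ : ℕ → ℚᵘ.ℚᵘ
  ℕ→ℚᵘ k = ℚᵘ.mkℚᵘ (ℤ.+ k) 0
  toℚᵘ-ℕ→ℚ : ∀ k → toℚᵘ (ℕ→ℚ k) ℚᵘ.≃ ℕ→ℚᵘ k
  toℚᵘ-ℕ→ℚ k = ℚP.toℚᵘ-fromℚᵘ (ℕ→ℚᵘ k)
  integral : ℤ.+ (m ℕ.+ n) ℤ.* (ℤ.+ 1 ℤ.* ℤ.+ 1)
           ≡ (ℤ.+ m ℤ.* ℤ.+ 1 ℤ.+ ℤ.+ n ℤ.* ℤ.+ 1) ℤ.* ℤ.+ 1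
  integral rewrite ℤP.*-identityʳ (ℤ.+ m) | ℤP.*-identityʳ (ℤ.+ n) = refl

ℕ→ℚ-∸ : ∀ {m n} → n ≤ m → ℕ→ℚ (m ∸ n) ≡ ℕ→ℚ m - ℕ→ℚ n
ℕ→ℚ-∸ {m} {n} n≤m = begin
    ℕ→ℚ (m ∸ n)
  ≡⟨ solve 2 (λ d e → d := (d :+ e) :- e) refl (ℕ→ℚ (m ∸ n)) (ℕ→ℚ n) ⟩
    (ℕ→ℚ (m ∸ n) + ℕ→ℚ n) - ℕ→ℚ n
  ≡⟨ cong (_- ℕ→ℚ n) (sym (ℕ→ℚ-+ (m ∸ n) n)) ⟩
    ℕ→ℚ (m ∸ n ℕ.+ n) - ℕ→ℚ n
  ≡⟨ cong (λ k → ℕ→ℚ k - ℕ→ℚ n) (ℕP.m∸n+n≡m n≤m) ⟩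
    ℕ→ℚ m - ℕ→ℚ n
  ∎
  where open ≡-Reasoning

^ℚ-+ : ∀ a m n → a ^ℚ (m ℕ.+ n) ≡ a ^ℚ m * a ^ℚ n
^ℚ-+ a zero    n = sym (ℚP.*-identityˡ (a ^ℚ n))
^ℚ-+ a (suc m) n = trans (cong (a *_) (^ℚ-+ a m n)) (sym (ℚP.*-assoc a (a ^ℚ m) (a ^ℚ n)))

Σ≤-cong : ∀ k {f g : ℕ → ℚ} → (∀ i → i ≤ k → f i ≡ g i) → Σ≤ k f ≡ Σ≤ k g
Σ≤-cong zero    f≡g = f≡g 0 z≤n
Σ≤-cong (suc k) f≡g =
  cong₂ _+_ (Σ≤-cong k (λ i i≤k → f≡g i (ℕP.m≤n⇒m≤1+n i≤k))) (f≡g (suc k) ℕP.≤-refl)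

Σ≤-cong′ : ∀ k {f g : ℕ → ℚ} → f ≗ g → Σ≤ k f ≡ Σ≤ k g
Σ≤-cong′ k f≗g = Σ≤-cong k (λ i _ → f≗g i)

Σ≤-+ : ∀ k (f g : ℕ → ℚ) → Σ≤ k (λ i → f i + g i) ≡ Σ≤ k f + Σ≤ k g
Σ≤-+ zero    f g = refl
Σ≤-+ (suc k) f g = trans (cong (_+ (f (suc k) + g (suc k))) (Σ≤-+ k f g))
  (solve 4 (λ F G a b → (F :+ G) :+ (a :+ b) := (F :+ a) :+ (G :+ b)) refl
     (Σ≤ k f) (Σ≤ k g) (f (suc k)) (g (suc k)))

Σ≤-- : ∀ k (f g : ℕ → ℚ) → Σ≤ k (λ i → f i - g i) ≡ Σ≤ k f - Σ≤ k g
Σ≤-- zero    f g = refl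
Σ≤-- (suc k) f g = trans (cong (_+ (f (suc k) - g (suc k))) (Σ≤-- k f g))
  (solve 4 (λ F G a b → (F :- G) :+ (a :- b) := (F :+ a) :- (G :+ b)) refl
     (Σ≤ k f) (Σ≤ k g) (f (suc k)) (g (suc k)))

Σ≤-* : ∀ k c (f : ℕ → ℚ) → Σ≤ k (λ i → c * f i) ≡ c * Σ≤ k f
Σ≤-* zero    c f = refl
Σ≤-* (suc k) c f = trans (cong (_+ (c * f (suc k))) (Σ≤-* k c f))
  (sym (ℚP.*-distribˡ-+ c (Σ≤ k f) (f (suc k))))

Σ≤-zero : ∀ k {f : ℕ → ℚ} → (∀ i → f i ≡ 0ℚ) → Σ≤ k f ≡ 0ℚ
Σ≤-zero zero    f≡0 = f≡0 0
Σ≤-zero (suc k) f≡0 = cong₂ _+_ (Σ≤-zero k f≡0) (f≡0 (suc k))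

Σ≤-head : ∀ k (f : ℕ → ℚ) → Σ≤ (suc k) f ≡ f 0 + Σ≤ k (λ i → f (suc i))
Σ≤-head zero    f = refl
Σ≤-head (suc k) f = trans (cong (_+ f (suc (suc k))) (Σ≤-head k f)) (ℚP.+-assoc (f 0) _ _)

Σ≤-linear : ∀ k x y (a b d e : ℕ → ℚ) →
            Σ≤ k (λ i → a i + x * b i + y * d i - y * e i)
            ≡ Σ≤ k a + x * Σ≤ k b + y * Σ≤ k d - y * Σ≤ k e
Σ≤-linear zero    x y a b d e = refl
Σ≤-linear (suc k) x y a b d e =
  trans (cong (_+ (a (suc k) + x * b (suc k) + y * d (suc k) - y * e (suc k))) (Σ≤-linear k x y a b d e))
  (solve 10 (λ x y A B D E a b d e →
       (A :+ x :* B :+ y :* D :- y :* E) :+ (a :+ x :* b :+ y :* d :- y :* e)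
    := (A :+ a) :+ x :* (B :+ b) :+ y :* (D :+ d) :- y :* (E :+ e)) refl
    x y (Σ≤ k a) (Σ≤ k b) (Σ≤ k d) (Σ≤ k e) (a (suc k)) (b (suc k)) (d (suc k)) (e (suc k)))

Σ≤-pascal : ∀ n (v : ℕ → ℚ) →
         Σ≤ (suc n) (λ i → ℕ→ℚ (suc (suc n) C i) * v i)
         ≡ Σ≤ n (λ i → ℕ→ℚ (suc n C i) * (v i + v (suc i))) + v (suc n)
Σ≤-pascal n v = begin
    Σ≤ (suc n) (λ i → ℕ→ℚ (suc (suc n) C i) * v i)
  ≡⟨ Σ≤-head n _ ⟩
    1ℚ * v 0 + Σ≤ n (λ i → ℕ→ℚ (suc (suc n) C suc i) * v (suc i))
  ≡⟨ cong (1ℚ * v 0 +_) (trans (Σ≤-cong′ n pascal-rule) (Σ≤-+ n _ _)) ⟩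
    1ℚ * v 0 + (A + B)
  ≡⟨ solve 4 (λ x A B c → c :* x :+ (A :+ B) := A :+ (c :* x :+ B)) refl (v 0) A B 1ℚ ⟩
    A + (1ℚ * v 0 + B)
  ≡⟨ cong (A +_) (sym (Σ≤-head n (λ i → c i * v i))) ⟩
    A + Σ≤ (suc n) (λ i → c i * v i)
  ≡⟨ cong (λ t → A + (S + ℕ→ℚ t * v (suc n))) (nCn≡1 (suc n)) ⟩
    A + (S + 1ℚ * v (suc n))
  ≡⟨ solve 3 (λ A S x → A :+ (S :+ con 1ℚ :* x) := (S :+ A) :+ x) refl A S (v (suc n)) ⟩
    (S + A) + v (suc n)
  ≡⟨ cong (_+ v (suc n)) (trans (sym (Σ≤-+ n _ _))
                                (Σ≤-cong′ n (λ i → sym (ℚP.*-distribˡ-+ (c i) (v i) (v (suc i)))))) ⟩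
    Σ≤ n (λ i → c i * (v i + v (suc i))) + v (suc n)
  ∎
  where
  open ≡-Reasoning
  c : ℕ → ℚ
  c i = ℕ→ℚ (suc n C i)
  A B S : ℚ
  A = Σ≤ n (λ i → c i * v (suc i))
  B = Σ≤ n (λ i → c (suc i) * v (suc i))
  S = Σ≤ n (λ i → c i * v i)
  pascal-rule : ∀ i → ℕ→ℚ (suc (suc n) C suc i) * v (suc i) ≡ c i * v (suc i) + c (suc i) * v (suc i)
  pascal-rule i = begin
    ℕ→ℚ (suc (suc n) C suc i) * v (suc i)
      ≡⟨ cong (λ t → ℕ→ℚ t * v (suc i)) (sym (nCk+nC[k+1]≡[n+1]C[k+1] (suc n) i)) ⟩
    ℕ→ℚ (suc n C i ℕ.+ suc n C suc i) * v (suc i)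
      ≡⟨ cong (_* v (suc i)) (ℕ→ℚ-+ (suc n C i) (suc n C suc i)) ⟩
    (c i + c (suc i)) * v (suc i)
      ≡⟨ ℚP.*-distribʳ-+ (v (suc i)) (c i) (c (suc i)) ⟩
    c i * v (suc i) + c (suc i) * v (suc i) ∎

scale : ℚ → Poly → Poly
scale c f k = c * f k

timesX : Poly → Poly
timesX f zero    = 0ℚ
timesX f (suc k) = f k

-- The Euler operator θ = x d/dx.
euler : Poly → Poly
euler f k = ℕ→ℚ k * f k

timesX-cong : ∀ {f g} → f ≗ g → timesX f ≗ timesX g
timesX-cong f≗g zero    = refl
timesX-cong f≗g (suc k) = f≗g k

euler-cong : ∀ {f g} → f ≗ g → euler f ≗ euler g
euler-cong f≗g k = cong (ℕ→ℚ k *_) (f≗g k)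

timesX-⊕ : ∀ f g → timesX (f ⊕ g) ≗ timesX f ⊕ timesX g
timesX-⊕ f g zero    = refl
timesX-⊕ f g (suc k) = refl

timesX-deriv : ∀ f → timesX (deriv f) ≗ euler f
timesX-deriv f zero    = sym (ℚP.*-zeroˡ (f 0))
timesX-deriv f (suc k) = refl

⊗-cong : ∀ {f f′ g g′} → f ≗ f′ → g ≗ g′ → f ⊗ g ≗ f′ ⊗ g′
⊗-cong f≗f′ g≗g′ k = Σ≤-cong′ k (λ i → cong₂ _*_ (f≗f′ i) (g≗g′ (k ∸ i)))

⊗-congˡ : ∀ {f f′} g → f ≗ f′ → f ⊗ g ≗ f′ ⊗ g
⊗-congˡ g f≗f′ = ⊗-cong {g = g} {g′ = g} f≗f′ (λ _ → refl)

⊗-congʳ : ∀ f {g g′} → g ≗ g′ → f ⊗ g ≗ f ⊗ g′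
⊗-congʳ f g≗g′ = ⊗-cong {f} {f} (λ _ → refl) g≗g′

⊗-distribʳ-⊕ : ∀ f g h → (f ⊕ g) ⊗ h ≗ f ⊗ h ⊕ g ⊗ h
⊗-distribʳ-⊕ f g h k =
  trans (Σ≤-cong′ k (λ i → ℚP.*-distribʳ-+ (h (k ∸ i)) (f i) (g i))) (Σ≤-+ k _ _)

⊗-distribʳ-⊖ : ∀ f g h → (f ⊖ g) ⊗ h ≗ f ⊗ h ⊖ g ⊗ h
⊗-distribʳ-⊖ f g h k = trans
  (Σ≤-cong′ k (λ i → solve 3 (λ a b c → (a :- b) :* c := a :* c :- b :* c) refl (f i) (g i) (h (k ∸ i))))
  (Σ≤-- k _ _)

scale-⊗ˡ : ∀ c f g → scale c f ⊗ g ≗ scale c (f ⊗ g)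
scale-⊗ˡ c f g k = trans (Σ≤-cong′ k (λ i → ℚP.*-assoc c (f i) (g (k ∸ i)))) (Σ≤-* k c _)

scale-⊗ʳ : ∀ c f g → f ⊗ scale c g ≗ scale c (f ⊗ g)
scale-⊗ʳ c f g k = trans
  (Σ≤-cong′ k (λ i → solve 3 (λ c a b → a :* (c :* b) := c :* (a :* b)) refl c (f i) (g (k ∸ i))))
  (Σ≤-* k c _)

timesX-⊗ˡ : ∀ f g → timesX f ⊗ g ≗ timesX (f ⊗ g)
timesX-⊗ˡ f g zero    = ℚP.*-zeroˡ (g 0)
timesX-⊗ˡ f g (suc k) = begin
    Σ≤ (suc k) (λ i → timesX f i * g (suc k ∸ i))
  ≡⟨ Σ≤-head k _ ⟩
    0ℚ * g (suc k) + Σ≤ k (λ i → f i * g (k ∸ i))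
  ≡⟨ cong (_+ Σ≤ k (λ i → f i * g (k ∸ i))) (ℚP.*-zeroˡ (g (suc k))) ⟩
    0ℚ + Σ≤ k (λ i → f i * g (k ∸ i))
  ≡⟨ ℚP.+-identityˡ _ ⟩
    Σ≤ k (λ i → f i * g (k ∸ i))
  ∎
  where open ≡-Reasoning

timesX-⊗ʳ : ∀ f g → f ⊗ timesX g ≗ timesX (f ⊗ g)
timesX-⊗ʳ f g zero    = ℚP.*-zeroʳ (f 0)
timesX-⊗ʳ f g (suc k) = begin
    Σ≤ k (λ i → f i * timesX g (suc k ∸ i)) + f (suc k) * timesX g (suc k ∸ suc k)
  ≡⟨ cong₂ _+_ (Σ≤-cong k (λ i i≤k → cong (λ t → f i * timesX g t) (ℕP.+-∸-assoc 1 i≤k)))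
               (cong (λ t → f (suc k) * timesX g t) (ℕP.n∸n≡0 k)) ⟩
    Σ≤ k (λ i → f i * g (k ∸ i)) + f (suc k) * 0ℚ
  ≡⟨ cong (Σ≤ k (λ i → f i * g (k ∸ i)) +_) (ℚP.*-zeroʳ (f (suc k))) ⟩
    Σ≤ k (λ i → f i * g (k ∸ i)) + 0ℚ
  ≡⟨ ℚP.+-identityʳ _ ⟩
    Σ≤ k (λ i → f i * g (k ∸ i))
  ∎
  where open ≡-Reasoning

constP-⊗ : ∀ c g → constP c ⊗ g ≗ scale c g
constP-⊗ c g zero    = refl
constP-⊗ c g (suc k) = begin
    Σ≤ (suc k) (λ i → constP c i * g (suc k ∸ i))
  ≡⟨ Σ≤-head k _ ⟩
    c * g (suc k) + Σ≤ k (λ i → 0ℚ * g (k ∸ i))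
  ≡⟨ cong (c * g (suc k) +_) (Σ≤-zero k (λ i → ℚP.*-zeroˡ (g (k ∸ i)))) ⟩
    c * g (suc k) + 0ℚ
  ≡⟨ ℚP.+-identityʳ _ ⟩
    c * g (suc k)
  ∎
  where open ≡-Reasoning

1P≗constP : 1P ≗ constP 1ℚ
1P≗constP zero    = refl
1P≗constP (suc k) = refl

⊗-identityˡ : ∀ g → 1P ⊗ g ≗ g
⊗-identityˡ g k = trans (⊗-congˡ g 1P≗constP k) (trans (constP-⊗ 1ℚ g k) (ℚP.*-identityˡ (g k)))

⊗-zeroʳ : ∀ f → f ⊗ 0P ≗ 0P
⊗-zeroʳ f k = Σ≤-zero k (λ i → ℚP.*-zeroʳ (f i))

xP-⊗ : ∀ g → xP ⊗ g ≗ timesX g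
xP-⊗ g k = trans (⊗-congˡ g xP≗timesX-1P k) (trans (timesX-⊗ˡ 1P g k) (timesX-cong (⊗-identityˡ g) k))
  where
  xP≗timesX-1P : xP ≗ timesX 1P
  xP≗timesX-1P zero          = refl
  xP≗timesX-1P (suc zero)    = refl
  xP≗timesX-1P (suc (suc k)) = refl

euler-⊗ : ∀ f g → euler (f ⊗ g) ≗ euler f ⊗ g ⊕ f ⊗ euler g
euler-⊗ f g k = trans (sym (Σ≤-* k (ℕ→ℚ k) _)) (trans (Σ≤-cong k split-degree) (Σ≤-+ k _ _))
  where
  split-degree : ∀ i → i ≤ k →
    ℕ→ℚ k * (f i * g (k ∸ i)) ≡ ℕ→ℚ i * f i * g (k ∸ i) + f i * (ℕ→ℚ (k ∸ i) * g (k ∸ i))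
  split-degree i i≤k = begin
      ℕ→ℚ k * (f i * g (k ∸ i))
    ≡⟨ cong (λ t → ℕ→ℚ t * (f i * g (k ∸ i))) (sym (ℕP.m+[n∸m]≡n i≤k)) ⟩
      ℕ→ℚ (i ℕ.+ (k ∸ i)) * (f i * g (k ∸ i))
    ≡⟨ cong (_* (f i * g (k ∸ i))) (ℕ→ℚ-+ i (k ∸ i)) ⟩
      (ℕ→ℚ i + ℕ→ℚ (k ∸ i)) * (f i * g (k ∸ i))
    ≡⟨ solve 4 (λ a b x y → (a :+ b) :* (x :* y) := a :* x :* y :+ x :* (b :* y)) refl
               (ℕ→ℚ i) (ℕ→ℚ (k ∸ i)) (f i) (g (k ∸ i)) ⟩
      ℕ→ℚ i * f i * g (k ∸ i) + f i * (ℕ→ℚ (k ∸ i) * g (k ∸ i))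
    ∎
    where open ≡-Reasoning

⊗-linearˡ : ∀ x y (a b d e g : Poly) →
  (a ⊕ scale x b ⊕ scale y d ⊖ scale y e) ⊗ g
  ≗ a ⊗ g ⊕ scale x (b ⊗ g) ⊕ scale y (d ⊗ g) ⊖ scale y (e ⊗ g)
⊗-linearˡ x y a b d e g k = trans (Σ≤-cong′ k distribute) (Σ≤-linear k x y _ _ _ _)
  where
  distribute : ∀ i → (a i + x * b i + y * d i - y * e i) * g (k ∸ i)
    ≡ a i * g (k ∸ i) + x * (b i * g (k ∸ i)) + y * (d i * g (k ∸ i)) - y * (e i * g (k ∸ i))
  distribute i = solve 7 (λ x y a b d e c →
       (a :+ x :* b :+ y :* d :- y :* e) :* c := a :* c :+ x :* (b :* c) :+ y :* (d :* c) :- y :* (e :* c))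
    refl x y (a i) (b i) (d i) (e i) (g (k ∸ i))

⊗-linearʳ : ∀ x y (a b d e f : Poly) →
  f ⊗ (a ⊕ scale x b ⊕ scale y d ⊖ scale y e)
  ≗ f ⊗ a ⊕ scale x (f ⊗ b) ⊕ scale y (f ⊗ d) ⊖ scale y (f ⊗ e)
⊗-linearʳ x y a b d e f k = trans (Σ≤-cong′ k distribute) (Σ≤-linear k x y _ _ _ _)
  where
  distribute : ∀ i → let j = k ∸ i in f i * (a j + x * b j + y * d j - y * e j)
    ≡ f i * a j + x * (f i * b j) + y * (f i * d j) - y * (f i * e j)
  distribute i = solve 7 (λ x y a b d e c →
       c :* (a :+ x :* b :+ y :* d :- y :* e) := c :* a :+ x :* (c :* b) :+ y :* (c :* d) :- y :* (c :* e))
    refl x y (a (k ∸ i)) (b (k ∸ i)) (d (k ∸ i)) (e (k ∸ i)) (f i)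

-- The operator L m f = (2mx + 1) f + 2x(1 − x) f′, with x f′ written as θ f.
L : ℕ → Poly → Poly
L m f = f ⊕ scale (two * ℕ→ℚ m) (timesX f) ⊕ scale two (euler f) ⊖ scale two (timesX (euler f))

L-cong : ∀ m {f g} → f ≗ g → L m f ≗ L m g
L-cong m f≗g k = cong₂ _-_
  (cong₂ _+_ (cong₂ _+_ (f≗g k) (cong (two * ℕ→ℚ m *_) (timesX-cong f≗g k)))
             (cong (two *_) (euler-cong f≗g k)))
  (cong (two *_) (timesX-cong (euler-cong f≗g) k))

L-⊗ˡ : ∀ a f g → L a f ⊗ g ≗ f ⊗ g ⊕ scale (two * ℕ→ℚ a) (timesX (f ⊗ g))
                               ⊕ scale two (euler f ⊗ g) ⊖ scale two (timesX (euler f ⊗ g))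
L-⊗ˡ a f g k = trans (⊗-linearˡ (two * ℕ→ℚ a) two f (timesX f) (euler f) (timesX (euler f)) g k)
  (cong₂ (λ s t → (f ⊗ g) k + two * ℕ→ℚ a * s + two * (euler f ⊗ g) k - two * t)
         (timesX-⊗ˡ f g k) (timesX-⊗ˡ (euler f) g k))

L-⊗ʳ : ∀ b f g → f ⊗ L b g ≗ f ⊗ g ⊕ scale (two * ℕ→ℚ b) (timesX (f ⊗ g))
                               ⊕ scale two (f ⊗ euler g) ⊖ scale two (timesX (f ⊗ euler g))
L-⊗ʳ b f g k = trans (⊗-linearʳ (two * ℕ→ℚ b) two g (timesX g) (euler g) (timesX (euler g)) f k)
  (cong₂ (λ s t → (f ⊗ g) k + two * ℕ→ℚ b * s + two * (f ⊗ euler g) k - two * t)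
         (timesX-⊗ʳ f g k) (timesX-⊗ʳ f (euler g) k))

L-leibniz : ∀ a b f g → L (a ℕ.+ b) (f ⊗ g) ≗ L a f ⊗ g ⊕ f ⊗ L b g ⊖ f ⊗ g
L-leibniz a b f g k = begin
    L (a ℕ.+ b) (f ⊗ g) k
  ≡⟨ cong₂ _-_ (cong₂ _+_ (cong (λ t → P + two * t * X) (ℕ→ℚ-+ a b))
                          (cong (two *_) (euler-⊗ f g k)))
               (cong (two *_) (timesX-cong (euler-⊗ f g) k)) ⟩
    P + two * (α + β) * X + two * (θf + θg) - two * timesX (euler f ⊗ g ⊕ f ⊗ euler g) k
  ≡⟨ cong (λ t → P + two * (α + β) * X + two * (θf + θg) - two * t)
          (timesX-⊕ (euler f ⊗ g) (f ⊗ euler g) k) ⟩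
    P + two * (α + β) * X + two * (θf + θg) - two * (xθf + xθg)
  ≡⟨ solve 9 (λ t P X α β θf θg xθf xθg →
          P :+ t :* (α :+ β) :* X :+ t :* (θf :+ θg) :- t :* (xθf :+ xθg)
       := (P :+ t :* α :* X :+ t :* θf :- t :* xθf) :+ (P :+ t :* β :* X :+ t :* θg :- t :* xθg) :- P)
       refl two P X α β θf θg xθf xθg ⟩
    (P + two * α * X + two * θf - two * xθf) + (P + two * β * X + two * θg - two * xθg) - P
  ≡⟨ cong₂ (λ s t → s + t - P) (L-⊗ˡ a f g k) (L-⊗ʳ b f g k) ⟨
    (L a f ⊗ g) k + (f ⊗ L b g) k - P
  ∎
  where
  open ≡-Reasoning
  P X α β θf θg xθf xθg : ℚ
  P = (f ⊗ g) k
  X = timesX (f ⊗ g) k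
  α = ℕ→ℚ a
  β = ℕ→ℚ b
  θf = (euler f ⊗ g) k
  θg = (f ⊗ euler g) k
  xθf = timesX (euler f ⊗ g) k
  xθg = timesX (f ⊗ euler g) k

module _ (n : ℕ) (c : ℕ → ℚ) where

  private
    combination : (ℕ → Poly) → Poly
    combination g k = Σ≤ n (λ i → c i * g i k)

  timesX-Σ : ∀ h → timesX (combination h) ≗ combination (λ i → timesX (h i))
  timesX-Σ h zero    = sym (Σ≤-zero n (λ i → ℚP.*-zeroʳ (c i)))
  timesX-Σ h (suc k) = refl

  euler-Σ : ∀ h → euler (combination h) ≗ combination (λ i → euler (h i))
  euler-Σ h k = trans (sym (Σ≤-* n (ℕ→ℚ k) _)) (Σ≤-cong′ n (λ i →
    solve 3 (λ x c a → x :* (c :* a) := c :* (x :* a)) refl (ℕ→ℚ k) (c i) (h i k)))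

  L-Σ : ∀ m h → L m (combination h) ≗ combination (λ i → L m (h i))
  L-Σ m h k = sym (begin
      Σ≤ n (λ i → c i * L m (h i) k)
    ≡⟨ Σ≤-cong′ n distribute ⟩
      Σ≤ n (λ i → c i * h i k + μ * (c i * timesX (h i) k)
                  + two * (c i * euler (h i) k) - two * (c i * timesX (euler (h i)) k))
    ≡⟨ Σ≤-linear n μ two _ _ _ _ ⟩
      combination h k + μ * combination (λ i → timesX (h i)) k
        + two * combination (λ i → euler (h i)) k - two * combination (λ i → timesX (euler (h i))) k
    ≡⟨ cong₂ (λ s t → combination h k + μ * s + two * t - two * combination (λ i → timesX (euler (h i))) k)
             (timesX-Σ h k) (euler-Σ h k) ⟨
      combination h k + μ * timesX (combination h) k
        + two * euler (combination h) k - two * combination (λ i → timesX (euler (h i))) k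
    ≡⟨ cong (λ t → combination h k + μ * timesX (combination h) k + two * euler (combination h) k - two * t)
            (trans (timesX-cong (euler-Σ h) k) (timesX-Σ (λ i → euler (h i)) k)) ⟨
      L m (combination h) k
    ∎)
    where
    open ≡-Reasoning
    μ : ℚ
    μ = two * ℕ→ℚ m
    distribute : ∀ i → c i * L m (h i) k ≡ c i * h i k + μ * (c i * timesX (h i) k)
                       + two * (c i * euler (h i) k) - two * (c i * timesX (euler (h i)) k)
    distribute i = solve 7 (λ c a x b t d e →
         c :* (a :+ x :* b :+ t :* d :- t :* e) := c :* a :+ x :* (c :* b) :+ t :* (c :* d) :- t :* (c :* e))
      refl (c i) (h i k) μ (timesX (h i) k) two (euler (h i) k) (timesX (euler (h i)) k)

constP⊗xP-⊗ : ∀ c g → constP c ⊗ xP ⊗ g ≗ scale c (timesX g)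
constP⊗xP-⊗ c g k = begin
    (constP c ⊗ xP ⊗ g) k  ≡⟨ ⊗-congˡ g (constP-⊗ c xP) k ⟩
    (scale c xP ⊗ g) k     ≡⟨ scale-⊗ˡ c xP g k ⟩
    c * (xP ⊗ g) k         ≡⟨ cong (c *_) (xP-⊗ g k) ⟩
    c * timesX g k         ∎
  where open ≡-Reasoning

twoX1mX-⊗-deriv : ∀ g → twoX1mX ⊗ deriv g ≗ scale two (euler g) ⊖ scale two (timesX (euler g))
twoX1mX-⊗-deriv g k = begin
    (twoX1mX ⊗ deriv g) k
  ≡⟨ ⊗-congˡ (deriv g) (⊗-congˡ (1P ⊖ xP) (constP-⊗ two xP)) k ⟩
    (scale two xP ⊗ (1P ⊖ xP) ⊗ deriv g) k
  ≡⟨ ⊗-congˡ (deriv g) (λ j → trans (scale-⊗ˡ two xP (1P ⊖ xP) j)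
                                     (cong (two *_) (xP-⊗ (1P ⊖ xP) j))) k ⟩
    (scale two (timesX (1P ⊖ xP)) ⊗ deriv g) k
  ≡⟨ scale-⊗ˡ two (timesX (1P ⊖ xP)) (deriv g) k ⟩
    two * (timesX (1P ⊖ xP) ⊗ deriv g) k
  ≡⟨ cong (two *_) (trans (timesX-⊗ˡ (1P ⊖ xP) (deriv g) k) (timesX-cong one-minus-x k)) ⟩
    two * timesX (deriv g ⊖ euler g) k
  ≡⟨ cong (two *_) (timesX-⊖ k) ⟩
    two * (euler g k - timesX (euler g) k)
  ≡⟨ solve 3 (λ t a b → t :* (a :- b) := t :* a :- t :* b) refl two (euler g k) (timesX (euler g) k) ⟩
    two * euler g k - two * timesX (euler g) k
  ∎
  where
  open ≡-Reasoning
  one-minus-x : (1P ⊖ xP) ⊗ deriv g ≗ deriv g ⊖ euler g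
  one-minus-x j = trans (⊗-distribʳ-⊖ 1P xP (deriv g) j)
    (cong₂ _-_ (⊗-identityˡ (deriv g) j) (trans (xP-⊗ (deriv g) j) (timesX-deriv g j)))
  timesX-⊖ : timesX (deriv g ⊖ euler g) ≗ euler g ⊖ timesX (euler g)
  timesX-⊖ zero    = sym (cong (_- 0ℚ) (ℚP.*-zeroˡ (g 0)))
  timesX-⊖ (suc j) = cong (_- euler g j) (timesX-deriv g (suc j))

qq-suc : ∀ m → qq (suc m) ≗ L m (qq m)
qq-suc m k = begin
    qq (suc m) k
  ≡⟨ cong₂ _+_ (⊗-distribʳ-⊕ (2P ⊗ constP (ℕ→ℚ m) ⊗ xP) 1P (qq m) k) (twoX1mX-⊗-deriv (qq m) k) ⟩
    (2P ⊗ constP (ℕ→ℚ m) ⊗ xP ⊗ qq m) k + (1P ⊗ qq m) k + (two * θq - two * xθq)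
  ≡⟨ cong₂ (λ s t → s + t + (two * θq - two * xθq))
           (trans (⊗-congˡ (qq m) (⊗-congˡ xP (λ j → trans (constP-⊗ two (constP (ℕ→ℚ m)) j)
                                                          (two-scale j))) k)
                  (constP⊗xP-⊗ (two * ℕ→ℚ m) (qq m) k))
           (⊗-identityˡ (qq m) k) ⟩
    two * ℕ→ℚ m * xq + qq m k + (two * θq - two * xθq)
  ≡⟨ solve 6 (λ t μ x q θ xθ →
         t :* μ :* x :+ q :+ (t :* θ :- t :* xθ) := q :+ t :* μ :* x :+ t :* θ :- t :* xθ)
       refl two (ℕ→ℚ m) xq (qq m k) θq xθq ⟩
    L m (qq m) k
  ∎
  where
  open ≡-Reasoning
  xq θq xθq : ℚ
  xq = timesX (qq m) k
  θq = euler (qq m) k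
  xθq = timesX (euler (qq m)) k
  two-scale : scale two (constP (ℕ→ℚ m)) ≗ constP (two * ℕ→ℚ m)
  two-scale zero    = refl
  two-scale (suc j) = ℚP.*-zeroʳ two

p-zero : p 0 ≗ 1P
p-zero k = trans
  (cong₂ (λ a b → a + b + 1P k) (⊗-zeroʳ (2P ⊗ (constP (ℕ→ℚ 0 - 1ℚ) ⊗ xP ⊕ 1P)) k)
                                (trans (⊗-congʳ twoX1mX deriv-0P k) (⊗-zeroʳ twoX1mX k)))
  (solve 1 (λ a → con 0ℚ :+ con 0ℚ :+ a := a) refl (1P k))
  where
  deriv-0P : deriv 0P ≗ 0P
  deriv-0P j = ℚP.*-zeroʳ (ℕ→ℚ (suc j))

p-suc : ∀ n → p (suc n) ≗ L n (p n) ⊕ p n ⊕ q n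
p-suc n k = begin
    p (suc n) k
  ≡⟨ cong₂ (λ s t → s + t + q n k) affine-part (twoX1mX-⊗-deriv P k) ⟩
    two * ((ℕ→ℚ (suc n) - 1ℚ) * xP′ + P k) + (two * θP - two * xθP) + q n k
  ≡⟨ cong (λ c → two * ((c - 1ℚ) * xP′ + P k) + (two * θP - two * xθP) + q n k) (ℕ→ℚ-+ 1 n) ⟩
    two * ((1ℚ + ℕ→ℚ n - 1ℚ) * xP′ + P k) + (two * θP - two * xθP) + q n k
  ≡⟨ solve 6 (λ ν x a θ xθ b → let t = con two in
                  t :* ((con 1ℚ :+ ν :- con 1ℚ) :* x :+ a) :+ (t :* θ :- t :* xθ) :+ b
               := (a :+ t :* ν :* x :+ t :* θ :- t :* xθ) :+ a :+ b)
       refl (ℕ→ℚ n) xP′ (P k) θP xθP (q n k) ⟩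
    L n P k + P k + q n k
  ∎
  where
  open ≡-Reasoning
  P : Poly
  P = p n
  xP′ θP xθP : ℚ
  xP′ = timesX P k
  θP = euler P k
  xθP = timesX (euler P) k
  affine : Poly
  affine = constP (ℕ→ℚ (suc n) - 1ℚ) ⊗ xP ⊕ 1P
  affine-part : (2P ⊗ affine ⊗ P) k ≡ two * ((ℕ→ℚ (suc n) - 1ℚ) * xP′ + P k)
  affine-part = begin
      (2P ⊗ affine ⊗ P) k     ≡⟨ ⊗-congˡ P (constP-⊗ two affine) k ⟩
      (scale two affine ⊗ P) k ≡⟨ scale-⊗ˡ two affine P k ⟩
      two * (affine ⊗ P) k
        ≡⟨ cong (two *_) (⊗-distribʳ-⊕ (constP (ℕ→ℚ (suc n) - 1ℚ) ⊗ xP) 1P P k) ⟩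
      two * ((constP (ℕ→ℚ (suc n) - 1ℚ) ⊗ xP ⊗ P) k + (1P ⊗ P) k)
        ≡⟨ cong (two *_) (cong₂ _+_ (constP⊗xP-⊗ _ P k) (⊗-identityˡ P k)) ⟩
      two * ((ℕ→ℚ (suc n) - 1ℚ) * xP′ + P k) ∎

binomialConvolution : ℕ → Poly
binomialConvolution n k = Σ≤ n (λ i → ℕ→ℚ (suc n C i) * (qq (n ∸ i) ⊗ qq i) k)

L-qq⊗qq : ∀ {n i} → i ≤ n →
  L n (qq (n ∸ i) ⊗ qq i) ≗ qq (suc n ∸ i) ⊗ qq i ⊕ qq (n ∸ i) ⊗ qq (suc i) ⊖ qq (n ∸ i) ⊗ qq i
L-qq⊗qq {n} {i} i≤n k = begin
    L n (qq (n ∸ i) ⊗ qq i) k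
  ≡⟨ cong (λ m → L m (qq (n ∸ i) ⊗ qq i) k) (sym (ℕP.m∸n+n≡m i≤n)) ⟩
    L (n ∸ i ℕ.+ i) (qq (n ∸ i) ⊗ qq i) k
  ≡⟨ L-leibniz (n ∸ i) i (qq (n ∸ i)) (qq i) k ⟩
    (L (n ∸ i) (qq (n ∸ i)) ⊗ qq i) k + (qq (n ∸ i) ⊗ L i (qq i)) k - (qq (n ∸ i) ⊗ qq i) k
  ≡⟨ cong₂ (λ s t → s + t - (qq (n ∸ i) ⊗ qq i) k)
           (⊗-congˡ (qq i) (λ j → trans (sym (qq-suc (n ∸ i) j))
                                        (cong (λ m → qq m j) (sym (ℕP.+-∸-assoc 1 i≤n)))) k)
           (⊗-congʳ (qq (n ∸ i)) (λ j → sym (qq-suc i j)) k) ⟩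
    (qq (suc n ∸ i) ⊗ qq i) k + (qq (n ∸ i) ⊗ qq (suc i)) k - (qq (n ∸ i) ⊗ qq i) k
  ∎
  where open ≡-Reasoning

p≗binomialConvolution : ∀ n → p n ≗ binomialConvolution n
p≗binomialConvolution zero k =
  trans (p-zero k) (sym (trans (ℚP.*-identityˡ _) (⊗-identityˡ 1P k)))
p≗binomialConvolution (suc n) k = begin
    p (suc n) k
  ≡⟨ p-suc n k ⟩
    L n (p n) k + p n k + q n k
  ≡⟨ cong₂ (λ s t → s + t + q n k) (L-cong n (p≗binomialConvolution n) k) (p≗binomialConvolution n k) ⟩
    L n (binomialConvolution n) k + binomialConvolution n k + q n k
  ≡⟨ cong (λ t → t + binomialConvolution n k + q n k)
          (trans (L-Σ n c n h k) (Σ≤-cong n (λ i i≤n → cong (c i *_) (L-qq⊗qq i≤n k)))) ⟩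
    Σ≤ n (λ i → c i * (u i + u (suc i) - h i k)) + Σ≤ n (λ i → c i * h i k) + q n k
  ≡⟨ cong (_+ q n k) (trans (sym (Σ≤-+ n _ _)) (Σ≤-cong′ n telescope)) ⟩
    Σ≤ n (λ i → c i * (u i + u (suc i))) + q n k
  ≡⟨ cong (Σ≤ n (λ i → c i * (u i + u (suc i))) +_) u-last ⟨
    Σ≤ n (λ i → c i * (u i + u (suc i))) + u (suc n)
  ≡⟨ Σ≤-pascal n u ⟨
    binomialConvolution (suc n) k
  ∎
  where
  open ≡-Reasoning
  c : ℕ → ℚ
  c i = ℕ→ℚ (suc n C i)
  h : ℕ → Poly
  h i = qq (n ∸ i) ⊗ qq i
  u : ℕ → ℚ
  u i = (qq (suc n ∸ i) ⊗ qq i) k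
  telescope : ∀ i → c i * (u i + u (suc i) - h i k) + c i * h i k ≡ c i * (u i + u (suc i))
  telescope i = solve 4 (λ c a b x → c :* (a :+ b :- x) :+ c :* x := c :* (a :+ b)) refl
                        (c i) (u i) (u (suc i)) (h i k)
  u-last : u (suc n) ≡ q n k
  u-last = trans (cong (λ m → (qq m ⊗ q n) k) (ℕP.n∸n≡0 n)) (⊗-identityˡ (q n) k)

-- The coefficients of (y + n x) g + x(1 − x) g′.
eulerianStep : ℕ → ℚ → Poly → Poly
eulerianStep n y g zero    = y * g 0
eulerianStep n y g (suc j) = (y + ℕ→ℚ (suc j)) * g (suc j) + (ℕ→ℚ n - ℕ→ℚ j) * g j

eulerianStep-cong : ∀ {n y g h} → g ≗ h → eulerianStep n y g ≗ eulerianStep n y h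
eulerianStep-cong {y = y} g≗h zero = cong (y *_) (g≗h 0)
eulerianStep-cong {n} {y} g≗h (suc j) =
  cong₂ (λ s t → (y + ℕ→ℚ (suc j)) * s + (ℕ→ℚ n - ℕ→ℚ j) * t) (g≗h (suc j)) (g≗h j)

record EulerianRecurrence (y : ℚ) (F : ℕ → Poly) : Set where
  field
    initial : F 0 ≗ 1P
    step    : ∀ n → F (suc n) ≗ eulerianStep n y (F n)

qq≗2^m*F : ∀ {F} → EulerianRecurrence ½ F → ∀ m → qq m ≗ scale (two ^ℚ m) (F m)
qq≗2^m*F {F} rec zero    k = sym (trans (ℚP.*-identityˡ (F 0 k)) (initial k))
  where open EulerianRecurrence rec
qq≗2^m*F {F} rec (suc m) k = trans (qq-suc m k) (trans (L-cong m (qq≗2^m*F rec m) k) (L-step k))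
  where
  open EulerianRecurrence rec
  t : ℚ
  t = two ^ℚ m
  L-step : ∀ k → L m (scale t (F m)) k ≡ two * t * F (suc m) k
  L-step zero = begin
      t * F m 0 + two * ℕ→ℚ m * 0ℚ + two * (0ℚ * (t * F m 0)) - two * 0ℚ
    ≡⟨ solve 3 (λ t a μ → t :* a :+ μ :* con 0ℚ :+ con two :* (con 0ℚ :* (t :* a)) :- con two :* con 0ℚ
                       := (con two :* t) :* (con ½ :* a))
         refl t (F m 0) (two * ℕ→ℚ m) ⟩
      two * t * (½ * F m 0)
    ≡⟨ cong (two * t *_) (step m 0) ⟨
      two * t * F (suc m) 0
    ∎
    where open ≡-Reasoning
  L-step (suc j) = begin
      t * F m (suc j) + two * ℕ→ℚ m * (t * F m j)
        + two * (ℕ→ℚ (suc j) * (t * F m (suc j))) - two * (ℕ→ℚ j * (t * F m j))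
    ≡⟨ solve 6 (λ t a b μ ι κ → let c = con two in
            t :* a :+ c :* μ :* (t :* b) :+ c :* (ι :* (t :* a)) :- c :* (κ :* (t :* b))
         := (c :* t) :* ((con ½ :+ ι) :* a :+ (μ :- κ) :* b))
         refl t (F m (suc j)) (F m j) (ℕ→ℚ m) (ℕ→ℚ (suc j)) (ℕ→ℚ j) ⟩
      two * t * ((½ + ℕ→ℚ (suc j)) * F m (suc j) + (ℕ→ℚ m - ℕ→ℚ j) * F m j)
    ≡⟨ cong (two * t *_) (step m (suc j)) ⟨
      two * t * F (suc m) (suc j)
    ∎
    where open ≡-Reasoning

binomialConvolution≗rhs : ∀ {F : ℕ → Poly} → (∀ m → qq m ≗ scale (two ^ℚ m) (F m)) → ∀ n →
  binomialConvolution n ≗ constP (two ^ℚ n) ⊗ ΣP n (λ i → constP (ℕ→ℚ (suc n C i)) ⊗ F (n ∸ i) ⊗ F i)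
binomialConvolution≗rhs {F} qq≗ n k = sym (begin
    (constP (two ^ℚ n) ⊗ ΣP n summand) k
  ≡⟨ constP-⊗ (two ^ℚ n) (ΣP n summand) k ⟩
    two ^ℚ n * Σ≤ n (λ i → summand i k)
  ≡⟨ Σ≤-* n (two ^ℚ n) _ ⟨
    Σ≤ n (λ i → two ^ℚ n * summand i k)
  ≡⟨ Σ≤-cong n term ⟩
    binomialConvolution n k
  ∎)
  where
  open ≡-Reasoning
  summand : ℕ → Poly
  summand i = constP (ℕ→ℚ (suc n C i)) ⊗ F (n ∸ i) ⊗ F i
  term : ∀ i → i ≤ n → two ^ℚ n * summand i k ≡ ℕ→ℚ (suc n C i) * (qq (n ∸ i) ⊗ qq i) k
  term i i≤n = begin
      two ^ℚ n * summand i k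
    ≡⟨ cong₂ _*_ (trans (cong (two ^ℚ_) (sym (ℕP.m∸n+n≡m i≤n))) (^ℚ-+ two (n ∸ i) i))
                 (trans (⊗-congˡ (F i) (constP-⊗ c (F (n ∸ i))) k) (scale-⊗ˡ c (F (n ∸ i)) (F i) k)) ⟩
      (a * b) * (c * (F (n ∸ i) ⊗ F i) k)
    ≡⟨ solve 4 (λ a b c x → (a :* b) :* (c :* x) := c :* (a :* (b :* x))) refl
               a b c ((F (n ∸ i) ⊗ F i) k) ⟩
      c * (a * (b * (F (n ∸ i) ⊗ F i) k))
    ≡⟨ cong (c *_) (trans (scale-⊗ˡ a (F (n ∸ i)) (scale b (F i)) k)
                          (cong (a *_) (scale-⊗ʳ b (F (n ∸ i)) (F i) k))) ⟨
      c * (scale a (F (n ∸ i)) ⊗ scale b (F i)) k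
    ≡⟨ cong (c *_) (⊗-cong (qq≗ (n ∸ i)) (qq≗ i) k) ⟨
      c * (qq (n ∸ i) ⊗ qq i) k
    ∎
    where
    c a b : ℚ
    c = ℕ→ℚ (suc n C i)
    a = two ^ℚ (n ∸ i)
    b = two ^ℚ i

-- Inserting a new maximum into a permutation

indicator : Bool → ℕ
indicator b = if b then 1 else 0

count : ∀ {n} → (Fin n → Bool) → ℕ
count P = ℕΣ.sum (indicator ∘ P)

count-cong : ∀ {n} {P Q : Fin n → Bool} → P ≗ Q → count P ≡ count Q
count-cong P≗Q = ℕΣ.sum-cong-≗ (cong indicator ∘ P≗Q)

count-init-last : ∀ {n} (P : Fin (suc n) → Bool) →
                  count P ≡ count (P ∘ inject₁) ℕ.+ indicator (P (fromℕ n))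
count-init-last P = ℕΣ.sum-init-last (indicator ∘ P)

count-+-count-not : ∀ {n} (P : Fin n → Bool) → count P ℕ.+ count (not ∘ P) ≡ n
count-+-count-not {zero}  P = refl
count-+-count-not {suc n} P with P Fin.zero
... | true  = cong suc (count-+-count-not (P ∘ Fin.suc))
... | false = trans (ℕP.+-suc _ _) (cong suc (count-+-count-not (P ∘ Fin.suc)))

count≤n : ∀ {n} (P : Fin n → Bool) → count P ≤ n
count≤n P = subst (count P ≤_) (count-+-count-not P) (ℕP.m≤m+n _ _)

count-set : ∀ {n} (P : Fin n → Bool) (a : Fin n) →
  count (λ i → if ⌊ i Fin.≟ a ⌋ then true else P i) ≡ count P ℕ.+ indicator (not (P a))
count-set {suc n} P Fin.zero with P Fin.zero
... | true  = cong suc (sym (ℕP.+-identityʳ _))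
... | false = ℕP.+-comm 1 _
count-set {suc n} P (Fin.suc a) = trans
  (cong (indicator (P Fin.zero) ℕ.+_) (trans (count-cong suc-≟) (count-set (P ∘ Fin.suc) a)))
  (sym (ℕP.+-assoc (indicator (P Fin.zero)) _ _))
  where
  suc-≟ : (λ i → if ⌊ Fin.suc i Fin.≟ Fin.suc a ⌋ then true else P (Fin.suc i))
        ≗ (λ i → if ⌊ i Fin.≟ a ⌋ then true else P (Fin.suc i))
  suc-≟ i with i Fin.≟ a
  ... | yes _ = refl
  ... | no  _ = refl

sum-if : ∀ {n} (P : Fin n → Bool) x z →
  sum (λ a → if P a then x else z) ≡ ℕ→ℚ (count P) * x + ℕ→ℚ (count (not ∘ P)) * z
sum-if {zero}  P x z = solve 2 (λ x z → con 0ℚ := con 0ℚ :* x :+ con 0ℚ :* z) refl x z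
sum-if {suc n} P x z =
  trans (cong ((if P Fin.zero then x else z) +_) (sum-if (P ∘ Fin.suc) x z)) (head (P Fin.zero))
  where
  k k′ : ℕ
  k = count (P ∘ Fin.suc)
  k′ = count (not ∘ P ∘ Fin.suc)
  head : ∀ b → (if b then x else z) + (ℕ→ℚ k * x + ℕ→ℚ k′ * z)
             ≡ ℕ→ℚ (indicator b ℕ.+ k) * x + ℕ→ℚ (indicator (not b) ℕ.+ k′) * z
  head true  = trans (solve 4 (λ x z a b → x :+ (a :* x :+ b :* z) := (con 1ℚ :+ a) :* x :+ b :* z) refl
                               x z (ℕ→ℚ k) (ℕ→ℚ k′))
                     (cong (λ t → t * x + ℕ→ℚ k′ * z) (sym (ℕ→ℚ-+ 1 k)))
  head false = trans (solve 4 (λ x z a b → z :+ (a :* x :+ b :* z) := a :* x :+ (con 1ℚ :+ b) :* z) refl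
                               x z (ℕ→ℚ k) (ℕ→ℚ k′))
                     (cong (λ t → ℕ→ℚ k * x + t * z) (sym (ℕ→ℚ-+ 1 k′)))

-- insertTop f ch extends f to Fin (suc n): the new element fromℕ n becomes a fixed point when
-- ch = fromℕ n, and is inserted right after a on the cycle of a when ch = inject₁ a.
insertTop : ∀ {n} → (Fin n → Fin n) → Fin (suc n) → Fin (suc n) → Fin (suc n)
insertTop f ch x with view ch | view x
... | ‵fromℕ     | ‵fromℕ     = fromℕ _
... | ‵fromℕ     | ‵inject₁ i = inject₁ (f i)
... | ‵inject₁ a | ‵fromℕ     = inject₁ (f a)
... | ‵inject₁ a | ‵inject₁ i = if ⌊ i Fin.≟ a ⌋ then fromℕ _ else inject₁ (f i)

module _ {n} (f : Fin n → Fin n) where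

  insertTop-fix-top : insertTop f (fromℕ n) (fromℕ n) ≡ fromℕ n
  insertTop-fix-top rewrite view-fromℕ n = refl

  insertTop-fix-inject₁ : ∀ i → insertTop f (fromℕ n) (inject₁ i) ≡ inject₁ (f i)
  insertTop-fix-inject₁ i rewrite view-fromℕ n | view-inject₁ i = refl

  insertTop-after-top : ∀ a → insertTop f (inject₁ a) (fromℕ n) ≡ inject₁ (f a)
  insertTop-after-top a rewrite view-fromℕ n | view-inject₁ a = refl

  insertTop-after-self : ∀ a → insertTop f (inject₁ a) (inject₁ a) ≡ fromℕ n
  insertTop-after-self a rewrite view-inject₁ a with a Fin.≟ a
  ... | yes _   = refl
  ... | no  a≢a = ⊥-elim (a≢a refl)

  insertTop-after-other : ∀ a i → i ≢ a → insertTop f (inject₁ a) (inject₁ i) ≡ inject₁ (f i)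
  insertTop-after-other a i i≢a rewrite view-inject₁ a | view-inject₁ i with i Fin.≟ a
  ... | yes i≡a = ⊥-elim (i≢a i≡a)
  ... | no  _   = refl

insertTop-cong : ∀ {n} {f g : Fin n → Fin n} → f ≗ g → ∀ ch → insertTop f ch ≗ insertTop g ch
insertTop-cong f≗g ch x with view ch | view x
... | ‵fromℕ     | ‵fromℕ     = refl
... | ‵fromℕ     | ‵inject₁ i = cong inject₁ (f≗g i)
... | ‵inject₁ a | ‵fromℕ     = cong inject₁ (f≗g a)
... | ‵inject₁ a | ‵inject₁ i with i Fin.≟ a
...   | yes _ = refl
...   | no  _ = cong inject₁ (f≗g i)

insertTop-injective : ∀ {n} {f : Fin n → Fin n} → Injective _≡_ _≡_ f →
                      ∀ ch → Injective _≡_ _≡_ (insertTop f ch)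
insertTop-injective {f = f} f-inj ch {x} {y} eq with view ch | view x | view y
... | ‵fromℕ     | ‵fromℕ     | ‵fromℕ     = refl
... | ‵fromℕ     | ‵fromℕ     | ‵inject₁ _ = ⊥-elim (FinP.fromℕ≢inject₁ eq)
... | ‵fromℕ     | ‵inject₁ _ | ‵fromℕ     = ⊥-elim (FinP.fromℕ≢inject₁ (sym eq))
... | ‵fromℕ     | ‵inject₁ _ | ‵inject₁ _ = cong inject₁ (f-inj (FinP.inject₁-injective eq))
... | ‵inject₁ _ | ‵fromℕ     | ‵fromℕ     = refl
... | ‵inject₁ a | ‵fromℕ     | ‵inject₁ j with j Fin.≟ a
...   | yes _   = ⊥-elim (FinP.fromℕ≢inject₁ (sym eq))
...   | no  j≢a = ⊥-elim (j≢a (sym (f-inj (FinP.inject₁-injective eq))))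
insertTop-injective {f = f} f-inj ch {x} {y} eq | ‵inject₁ a | ‵inject₁ i | ‵fromℕ with i Fin.≟ a
...   | yes _   = ⊥-elim (FinP.fromℕ≢inject₁ eq)
...   | no  i≢a = ⊥-elim (i≢a (f-inj (FinP.inject₁-injective eq)))
insertTop-injective {f = f} f-inj ch {x} {y} eq | ‵inject₁ a | ‵inject₁ i | ‵inject₁ j
  with i Fin.≟ a | j Fin.≟ a
...   | yes i≡a | yes j≡a = cong inject₁ (trans i≡a (sym j≡a))
...   | yes _   | no  _   = ⊥-elim (FinP.fromℕ≢inject₁ eq)
...   | no  _   | yes _   = ⊥-elim (FinP.fromℕ≢inject₁ (sym eq))
...   | no  _   | no  _   = cong inject₁ (f-inj (FinP.inject₁-injective eq))

fromℕ-or-inject₁ : ∀ {n} (x : Fin (suc n)) → x ≡ fromℕ n ⊎ ∃ λ a → x ≡ inject₁ a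
fromℕ-or-inject₁ x with view x
... | ‵fromℕ     = inj₁ refl
... | ‵inject₁ a = inj₂ (a , refl)

module _ {n} {f : Fin n → Fin n} where

  insertTop-injective⁻ : ∀ ch → Injective _≡_ _≡_ (insertTop f ch) → Injective _≡_ _≡_ f
  insertTop-injective⁻ ch g-inj {i} {j} fi≡fj with fromℕ-or-inject₁ ch
  ... | inj₁ refl = FinP.inject₁-injective (g-inj (begin
      insertTop f (fromℕ n) (inject₁ i) ≡⟨ insertTop-fix-inject₁ f i ⟩
      inject₁ (f i)                     ≡⟨ cong inject₁ fi≡fj ⟩
      inject₁ (f j)                     ≡⟨ insertTop-fix-inject₁ f j ⟨
      insertTop f (fromℕ n) (inject₁ j) ∎))
    where open ≡-Reasoning
  ... | inj₂ (a , refl) with i Fin.≟ a | j Fin.≟ a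
  ...   | yes i≡a | yes j≡a = trans i≡a (sym j≡a)
  ...   | yes refl | no j≢a = ⊥-elim (FinP.fromℕ≢inject₁ (g-inj
          (trans (insertTop-after-top f i) (trans (cong inject₁ fi≡fj) (sym (insertTop-after-other f i j j≢a))))))
  ...   | no i≢a | yes refl = ⊥-elim (FinP.fromℕ≢inject₁ (sym (g-inj
          (trans (insertTop-after-other f j i i≢a) (trans (cong inject₁ fi≡fj) (sym (insertTop-after-top f j)))))))
  ...   | no i≢a | no j≢a = FinP.inject₁-injective (g-inj
          (trans (insertTop-after-other f a i i≢a)
                 (trans (cong inject₁ fi≡fj) (sym (insertTop-after-other f a j j≢a)))))

insertTop-injective₂ : ∀ {n} {f g : Fin n → Fin n} ch ch′ →
                       insertTop f ch ≗ insertTop g ch′ → f ≗ g × ch ≡ ch′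
insertTop-injective₂ {n} {f} {g} ch ch′ eq with fromℕ-or-inject₁ ch | fromℕ-or-inject₁ ch′
... | inj₁ refl | inj₁ refl = (λ i → FinP.inject₁-injective
        (trans (sym (insertTop-fix-inject₁ f i)) (trans (eq (inject₁ i)) (insertTop-fix-inject₁ g i)))) , refl
... | inj₁ refl | inj₂ (a′ , refl) = ⊥-elim (FinP.fromℕ≢inject₁
        (trans (sym (insertTop-fix-top f)) (trans (eq (fromℕ n)) (insertTop-after-top g a′))))
... | inj₂ (a , refl) | inj₁ refl = ⊥-elim (FinP.fromℕ≢inject₁
        (trans (sym (insertTop-fix-top g)) (trans (sym (eq (fromℕ n))) (insertTop-after-top f a))))
... | inj₂ (a , refl) | inj₂ (a′ , refl) with a Fin.≟ a′
...   | no a≢a′ = ⊥-elim (FinP.fromℕ≢inject₁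
          (trans (sym (insertTop-after-self f a)) (trans (eq (inject₁ a)) (insertTop-after-other g a′ a a≢a′))))
...   | yes refl = pointwise , refl
  where
  pointwise : f ≗ g
  pointwise i with i Fin.≟ a
  ... | yes refl = FinP.inject₁-injective
          (trans (sym (insertTop-after-top f i)) (trans (eq (fromℕ n)) (insertTop-after-top g i)))
  ... | no i≢a = FinP.inject₁-injective
          (trans (sym (insertTop-after-other f a i i≢a)) (trans (eq (inject₁ i)) (insertTop-after-other g a i i≢a)))

module _ {n} {g : Fin (suc n) → Fin (suc n)} (g-inj : Injective _≡_ _≡_ g) where

  preimage-fromℕ : ∃ λ p → g p ≡ fromℕ n
  preimage-fromℕ with FinP.any? (λ x → g x Fin.≟ fromℕ n)
  ... | yes found  = found
  ... | no  ¬found = ⊥-elim (ℕP.1+n≰n (FinP.injective⇒≤ lower-inj))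
    where
    n≢g : ∀ x → n ≢ toℕ (g x)
    n≢g x n≡gx = ¬found (x , FinP.toℕ-injective (trans (sym n≡gx) (sym (FinP.toℕ-fromℕ n))))
    lower-inj : Injective _≡_ _≡_ (λ x → Fin.lower₁ (g x) (n≢g x))
    lower-inj {x} {y} eq = g-inj (begin
      g x                           ≡⟨ FinP.inject₁-lower₁ (g x) (n≢g x) ⟨
      inject₁ (Fin.lower₁ (g x) _)  ≡⟨ cong inject₁ eq ⟩
      inject₁ (Fin.lower₁ (g y) _)  ≡⟨ FinP.inject₁-lower₁ (g y) (n≢g y) ⟩
      g y                           ∎)
      where open ≡-Reasoning

  module _ (p : Fin (suc n)) (gp≡top : g p ≡ fromℕ n) where

    -- g composed with the transposition of p and fromℕ n fixes fromℕ n; removeTop is its restriction.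
    private
      source : Fin n → Fin (suc n)
      source i = if ⌊ inject₁ i Fin.≟ p ⌋ then fromℕ n else inject₁ i

      source≢p : ∀ i → source i ≢ p
      source≢p i with inject₁ i Fin.≟ p
      ... | yes i≡p = λ top≡p → FinP.fromℕ≢inject₁ (trans top≡p (sym i≡p))
      ... | no  i≢p = i≢p

      n≢g∘source : ∀ i → n ≢ toℕ (g (source i))
      n≢g∘source i n≡ = source≢p i (g-inj (trans
        (FinP.toℕ-injective (trans (sym n≡) (sym (FinP.toℕ-fromℕ n)))) (sym gp≡top)))

    removeTop : Fin n → Fin n
    removeTop i = Fin.lower₁ (g (source i)) (n≢g∘source i)

    private
      inject₁-removeTop : ∀ i → inject₁ (removeTop i) ≡ g (source i)
      inject₁-removeTop i = FinP.inject₁-lower₁ (g (source i)) (n≢g∘source i)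

      source-p : ∀ i → inject₁ i ≡ p → source i ≡ fromℕ n
      source-p i i≡p with inject₁ i Fin.≟ p
      ... | yes _   = refl
      ... | no  i≢p = ⊥-elim (i≢p i≡p)

      source-other : ∀ i → inject₁ i ≢ p → source i ≡ inject₁ i
      source-other i i≢p with inject₁ i Fin.≟ p
      ... | yes i≡p = ⊥-elim (i≢p i≡p)
      ... | no  _   = refl

    insertTop-removeTop : insertTop removeTop p ≗ g
    insertTop-removeTop x with fromℕ-or-inject₁ p | fromℕ-or-inject₁ x
    ... | inj₁ refl | inj₁ refl = trans (insertTop-fix-top removeTop) (sym gp≡top)
    ... | inj₁ refl | inj₂ (i , refl) = trans (insertTop-fix-inject₁ removeTop i)
          (trans (inject₁-removeTop i) (cong g (source-other i (FinP.fromℕ≢inject₁ ∘ sym))))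
    ... | inj₂ (a , refl) | inj₁ refl = trans (insertTop-after-top removeTop a)
          (trans (inject₁-removeTop a) (cong g (source-p a refl)))
    ... | inj₂ (a , refl) | inj₂ (i , refl) with i Fin.≟ a
    ...   | yes refl = trans (insertTop-after-self removeTop i) (sym gp≡top)
    ...   | no  i≢a  = trans (insertTop-after-other removeTop a i i≢a)
          (trans (inject₁-removeTop i) (cong g (source-other i (i≢a ∘ FinP.inject₁-injective))))

<ᵇ-true : ∀ {m n} → m < n → (m <ᵇ n) ≡ true
<ᵇ-true m<n = Equivalence.to T-≡ (ℕP.<⇒<ᵇ m<n)

<ᵇ-false : ∀ {m n} → n ≤ m → (m <ᵇ n) ≡ false
<ᵇ-false {m} {n} n≤m with m <ᵇ n in m<ᵇn
... | false = refl
... | true  = ⊥-elim (ℕP.<⇒≱ (ℕP.<ᵇ⇒< m n (Equivalence.from T-≡ m<ᵇn)) n≤m)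

isExcedance : ∀ {n} → (Fin n → Fin n) → Fin n → Bool
isExcedance f i = toℕ i <ᵇ toℕ (f i)

excedances : ∀ {n} → (Fin n → Fin n) → ℕ
excedances f = count (isExcedance f)

excedances-cong : ∀ {n} {f g : Fin n → Fin n} → f ≗ g → excedances f ≡ excedances g
excedances-cong f≗g = count-cong (λ i → cong (λ y → toℕ i <ᵇ toℕ y) (f≗g i))

module _ {n} (f : Fin n → Fin n) where

  excedances-fix : excedances (insertTop f (fromℕ n)) ≡ excedances f
  excedances-fix = begin
      excedances g
    ≡⟨ count-init-last (isExcedance g) ⟩
      count (isExcedance g ∘ inject₁) ℕ.+ indicator (isExcedance g (fromℕ n))
    ≡⟨ cong₂ ℕ._+_ (count-cong old) (cong indicator new) ⟩
      excedances f ℕ.+ 0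
    ≡⟨ ℕP.+-identityʳ _ ⟩
      excedances f
    ∎
    where
    open ≡-Reasoning
    g : Fin (suc n) → Fin (suc n)
    g = insertTop f (fromℕ n)
    old : ∀ i → isExcedance g (inject₁ i) ≡ isExcedance f i
    old i rewrite insertTop-fix-inject₁ f i | FinP.toℕ-inject₁ i | FinP.toℕ-inject₁ (f i) = refl
    new : isExcedance g (fromℕ n) ≡ false
    new rewrite insertTop-fix-top f = <ᵇ-false {toℕ (fromℕ n)} ℕP.≤-refl

  excedances-after : ∀ a →
    excedances (insertTop f (inject₁ a)) ≡ excedances f ℕ.+ indicator (not (isExcedance f a))
  excedances-after a = begin
      excedances g
    ≡⟨ count-init-last (isExcedance g) ⟩
      count (isExcedance g ∘ inject₁) ℕ.+ indicator (isExcedance g (fromℕ n))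
    ≡⟨ cong₂ ℕ._+_ (trans (count-cong old) (count-set (isExcedance f) a)) (cong indicator new) ⟩
      excedances f ℕ.+ indicator (not (isExcedance f a)) ℕ.+ 0
    ≡⟨ ℕP.+-identityʳ _ ⟩
      excedances f ℕ.+ indicator (not (isExcedance f a))
    ∎
    where
    open ≡-Reasoning
    g : Fin (suc n) → Fin (suc n)
    g = insertTop f (inject₁ a)
    old : ∀ i → isExcedance g (inject₁ i) ≡ (if ⌊ i Fin.≟ a ⌋ then true else isExcedance f i)
    old i with i Fin.≟ a
    ... | yes refl rewrite insertTop-after-self f i | FinP.toℕ-inject₁ i | FinP.toℕ-fromℕ n =
          <ᵇ-true (FinP.toℕ<n i)
    ... | no  i≢a  rewrite insertTop-after-other f a i i≢a | FinP.toℕ-inject₁ i | FinP.toℕ-inject₁ (f i) =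
          refl
    new : isExcedance g (fromℕ n) ≡ false
    new rewrite insertTop-after-top f a | FinP.toℕ-fromℕ n | FinP.toℕ-inject₁ (f a) =
      <ᵇ-false (ℕP.<⇒≤ (FinP.toℕ<n (f a)))

iterate : ∀ {n} → (Fin n → Fin n) → ℕ → Fin n → Fin n
iterate f zero    x = x
iterate f (suc t) x = f (iterate f t x)

iterate-+ : ∀ {n} (f : Fin n → Fin n) s t x → iterate f (s ℕ.+ t) x ≡ iterate f s (iterate f t x)
iterate-+ f zero    t x = refl
iterate-+ f (suc s) t x = cong f (iterate-+ f s t x)

iterate-injective : ∀ {n} {f : Fin n → Fin n} → Injective _≡_ _≡_ f →
                    ∀ t → Injective _≡_ _≡_ (iterate f t)
iterate-injective f-inj zero    eq = eq
iterate-injective f-inj (suc t) eq = iterate-injective f-inj t (f-inj eq)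

iterate-cong : ∀ {n} {f g : Fin n → Fin n} → f ≗ g → ∀ t → iterate f t ≗ iterate g t
iterate-cong f≗g zero    x = refl
iterate-cong {g = g} f≗g (suc t) x = trans (f≗g _) (cong g (iterate-cong f≗g t x))

period : ∀ {n} {f : Fin n → Fin n} → Injective _≡_ _≡_ f →
         ∀ i → ∃ λ d → 1 ≤ d × d ≤ n × iterate f d i ≡ i
period {n} {f} f-inj i with FinP.pigeonhole (ℕP.n<1+n n) (λ (t : Fin (suc n)) → iterate f (toℕ t) i)
... | s , t , s<t , fˢi≡fᵗi = toℕ t ∸ toℕ s , ℕP.m<n⇒0<n∸m s<t ,
      ℕP.≤-trans (ℕP.m∸n≤m (toℕ t) (toℕ s)) (ℕP.≤-pred (FinP.toℕ<n t)) ,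
      sym (iterate-injective f-inj (toℕ s) (trans fˢi≡fᵗi
        (trans (cong (λ m → iterate f m i) (sym (ℕP.m+[n∸m]≡n (ℕP.<⇒≤ s<t))))
               (iterate-+ f (toℕ s) (toℕ t ∸ toℕ s) i))))

allᵇ-applyUpTo⁻ : ∀ n (P : ℕ → Bool) (g : ℕ → ℕ) →
                  allᵇ P (applyUpTo g n) ≡ true → ∀ t → t < n → P (g t) ≡ true
allᵇ-applyUpTo⁻ (suc n) P g all≡true t t<n with P (g 0) in P0
allᵇ-applyUpTo⁻ (suc n) P g all≡true zero    _           | true = P0
allᵇ-applyUpTo⁻ (suc n) P g all≡true (suc t) (ℕ.s≤s t<n) | true =
  allᵇ-applyUpTo⁻ n P (g ∘ suc) all≡true t t<n

allᵇ-applyUpTo⁺ : ∀ n (P : ℕ → Bool) (g : ℕ → ℕ) →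
                  (∀ t → t < n → P (g t) ≡ true) → allᵇ P (applyUpTo g n) ≡ true
allᵇ-applyUpTo⁺ zero    P g all = refl
allᵇ-applyUpTo⁺ (suc n) P g all rewrite all 0 (ℕ.s≤s z≤n) =
  allᵇ-applyUpTo⁺ n P (g ∘ suc) (λ t t<n → all (suc t) (ℕ.s≤s t<n))

allᵇ-cong : ∀ {A : Set} {P Q : A → Bool} → P ≗ Q → ∀ xs → allᵇ P xs ≡ allᵇ Q xs
allᵇ-cong P≗Q []       = refl
allᵇ-cong P≗Q (x ∷ xs) = cong₂ _∧_ (P≗Q x) (allᵇ-cong P≗Q xs)

IsCycleMin : ∀ {n} → (Fin n → Fin n) → Fin n → Set
IsCycleMin f i = ∀ t → toℕ i ≤ toℕ (iterate f t i)

isCycleMin : ∀ {n} → (Fin n → Fin n) → Fin n → Bool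
isCycleMin {n} f i = allᵇ (λ t → toℕ i ≤ᵇ toℕ (iterate f (suc t) i)) (upTo n)

cycles : ∀ {n} → (Fin n → Fin n) → ℕ
cycles f = count (isCycleMin f)

cycles-cong : ∀ {n} {f g : Fin n → Fin n} → f ≗ g → cycles f ≡ cycles g
cycles-cong {n} f≗g = count-cong (λ i →
  allᵇ-cong (λ t → cong (λ y → toℕ i ≤ᵇ toℕ y) (iterate-cong f≗g (suc t) i)) (upTo n))

isCycleMin-complete : ∀ {n} {f : Fin n → Fin n} {i} → IsCycleMin f i → isCycleMin f i ≡ true
isCycleMin-complete {n} min =
  allᵇ-applyUpTo⁺ n _ (λ t → t) (λ t _ → Equivalence.to T-≡ (ℕP.≤⇒≤ᵇ (min (suc t))))

-- Checking n iterates suffices because every orbit has period at most n.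
isCycleMin-sound : ∀ {n} {f : Fin n → Fin n} → Injective _≡_ _≡_ f →
                   ∀ {i} → isCycleMin f i ≡ true → IsCycleMin f i
isCycleMin-sound {n} {f} f-inj {i} checked with period f-inj i
... | d , 1≤d , d≤n , fᵈi≡i = λ t → bounded t t ℕP.≤-refl
  where
  within-n : ∀ t → t < n → toℕ i ≤ toℕ (iterate f (suc t) i)
  within-n t t<n = ℕP.≤ᵇ⇒≤ _ _ (Equivalence.from T-≡ (allᵇ-applyUpTo⁻ n _ (λ t → t) checked t t<n))
  bounded : ∀ k t → t ≤ k → toℕ i ≤ toℕ (iterate f t i)
  bounded k zero _ = ℕP.≤-refl
  bounded k (suc t) t<k with suc t ℕ.≤? n
  ... | yes t<n = within-n t t<n
  bounded zero    (suc t) () | no _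
  bounded (suc k) (suc t) t<k | no t≮n =
    subst (λ x → toℕ i ≤ toℕ x) (sym drop-period)
          (bounded k (suc t ∸ d) (ℕP.≤-pred (ℕP.≤-trans (ℕP.∸-monoʳ-< 1≤d d≤t) t<k)))
    where
    d≤t : d ≤ suc t
    d≤t = ℕP.≤-trans d≤n (ℕP.<⇒≤ (ℕP.≰⇒> t≮n))
    drop-period : iterate f (suc t) i ≡ iterate f (suc t ∸ d) i
    drop-period = trans (cong (λ m → iterate f m i) (sym (ℕP.m∸n+n≡m d≤t)))
                        (trans (iterate-+ f (suc t ∸ d) d i) (cong (iterate f (suc t ∸ d)) fᵈi≡i))

module _ {n} {f : Fin n → Fin n} (f-inj : Injective _≡_ _≡_ f) where

  private
    isCycleMin-transfer : ∀ {m} {g : Fin m → Fin m} (g-inj : Injective _≡_ _≡_ g) {i j} →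
      (IsCycleMin f i → IsCycleMin g j) → (IsCycleMin g j → IsCycleMin f i) →
      isCycleMin g j ≡ isCycleMin f i
    isCycleMin-transfer g-inj to from = ⇔→≡ (mk⇔
      (λ g-min → isCycleMin-complete (from (isCycleMin-sound g-inj g-min)))
      (λ f-min → isCycleMin-complete (to (isCycleMin-sound f-inj f-min))))

    ≤-inject₁ : ∀ {i j : Fin n} {x} → x ≡ inject₁ j → toℕ i ≤ toℕ j → toℕ (inject₁ i) ≤ toℕ x
    ≤-inject₁ {i} {j} refl = subst₂ _≤_ (sym (FinP.toℕ-inject₁ i)) (sym (FinP.toℕ-inject₁ j))

    ≤-inject₁⁻ : ∀ {i j : Fin n} {x} → x ≡ inject₁ j → toℕ (inject₁ i) ≤ toℕ x → toℕ i ≤ toℕ j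
    ≤-inject₁⁻ {i} {j} refl = subst₂ _≤_ (FinP.toℕ-inject₁ i) (FinP.toℕ-inject₁ j)

    ≤-fromℕ : ∀ (y : Fin (suc n)) {x} → x ≡ fromℕ n → toℕ y ≤ toℕ x
    ≤-fromℕ y refl = subst (toℕ y ≤_) (sym (FinP.toℕ-fromℕ n)) (ℕP.≤-pred (FinP.toℕ<n y))

  cycles-fix : cycles (insertTop f (fromℕ n)) ≡ suc (cycles f)
  cycles-fix = trans (count-init-last (isCycleMin g)) (trans
    (cong₂ ℕ._+_ (count-cong old) (cong indicator (isCycleMin-complete new)))
    (ℕP.+-comm (cycles f) 1))
    where
    g : Fin (suc n) → Fin (suc n)
    g = insertTop f (fromℕ n)
    iterate-inject₁ : ∀ t i → iterate g t (inject₁ i) ≡ inject₁ (iterate f t i)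
    iterate-inject₁ zero    i = refl
    iterate-inject₁ (suc t) i =
      trans (cong g (iterate-inject₁ t i)) (insertTop-fix-inject₁ f (iterate f t i))
    iterate-top : ∀ t → iterate g t (fromℕ n) ≡ fromℕ n
    iterate-top zero    = refl
    iterate-top (suc t) = trans (cong g (iterate-top t)) (insertTop-fix-top f)
    old : ∀ i → isCycleMin g (inject₁ i) ≡ isCycleMin f i
    old i = isCycleMin-transfer (insertTop-injective f-inj (fromℕ n))
      (λ min t → ≤-inject₁ (iterate-inject₁ t i) (min t))
      (λ min t → ≤-inject₁⁻ (iterate-inject₁ t i) (min t))
    new : IsCycleMin g (fromℕ n)
    new t = ≤-fromℕ (fromℕ n) (iterate-top t)

  -- Inserting n after a only lengthens the cycle of a, whose minimum is not n.
  cycles-after : ∀ a → cycles (insertTop f (inject₁ a)) ≡ cycles f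
  cycles-after a = trans (count-init-last (isCycleMin g))
    (trans (cong₂ ℕ._+_ (count-cong old) (cong indicator new)) (ℕP.+-identityʳ _))
    where
    g : Fin (suc n) → Fin (suc n)
    g = insertTop f (inject₁ a)
    g-inj : Injective _≡_ _≡_ g
    g-inj = insertTop-injective f-inj (inject₁ a)
    g-orbit⊆f-orbit : ∀ i t → (∃ λ s → iterate g t (inject₁ i) ≡ inject₁ (iterate f s i))
                             ⊎ (iterate g t (inject₁ i) ≡ fromℕ n × ∃ λ s → iterate f s i ≡ a)
    g-orbit⊆f-orbit i zero = inj₁ (0 , refl)
    g-orbit⊆f-orbit i (suc t) with g-orbit⊆f-orbit i t
    ... | inj₂ (gᵗi≡top , s , fˢi≡a) = inj₁ (suc s ,
          trans (cong g gᵗi≡top) (trans (insertTop-after-top f a) (cong (inject₁ ∘ f) (sym fˢi≡a))))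
    ... | inj₁ (s , gᵗi≡fˢi) with iterate f s i Fin.≟ a
    ...   | yes fˢi≡a =
          inj₂ (trans (cong g (trans gᵗi≡fˢi (cong inject₁ fˢi≡a))) (insertTop-after-self f a) , s , fˢi≡a)
    ...   | no  fˢi≢a = inj₁ (suc s , trans (cong g gᵗi≡fˢi) (insertTop-after-other f a _ fˢi≢a))
    f-orbit⊆g-orbit : ∀ i s → ∃ λ t → iterate g t (inject₁ i) ≡ inject₁ (iterate f s i)
    f-orbit⊆g-orbit i zero = 0 , refl
    f-orbit⊆g-orbit i (suc s) with f-orbit⊆g-orbit i s | iterate f s i Fin.≟ a
    ... | t , gᵗi≡fˢi | no fˢi≢a = suc t , trans (cong g gᵗi≡fˢi) (insertTop-after-other f a _ fˢi≢a)
    ... | t , gᵗi≡fˢi | yes fˢi≡a = suc (suc t) , (begin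
        g (g (iterate g t (inject₁ i))) ≡⟨ cong (g ∘ g) (trans gᵗi≡fˢi (cong inject₁ fˢi≡a)) ⟩
        g (g (inject₁ a))               ≡⟨ cong g (insertTop-after-self f a) ⟩
        g (fromℕ n)                     ≡⟨ insertTop-after-top f a ⟩
        inject₁ (f a)                   ≡⟨ cong (inject₁ ∘ f) fˢi≡a ⟨
        inject₁ (f (iterate f s i))     ∎)
      where open ≡-Reasoning
    old : ∀ i → isCycleMin g (inject₁ i) ≡ isCycleMin f i
    old i = isCycleMin-transfer g-inj
      (λ min t → [ (λ { (s , gᵗi≡fˢi) → ≤-inject₁ gᵗi≡fˢi (min s) })
                 , (λ { (gᵗi≡top , _) → ≤-fromℕ (inject₁ i) gᵗi≡top }) ]′ (g-orbit⊆f-orbit i t))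
      (λ min s → let (t , gᵗi≡fˢi) = f-orbit⊆g-orbit i s in ≤-inject₁⁻ gᵗi≡fˢi (min t))
    new : isCycleMin g (fromℕ n) ≡ false
    new with isCycleMin g (fromℕ n) in min
    ... | false = refl
    ... | true  = ⊥-elim (ℕP.<⇒≱ (FinP.toℕ<n (f a)) (subst₂ _≤_ (FinP.toℕ-fromℕ n)
                    (trans (cong toℕ (insertTop-after-top f a)) (FinP.toℕ-inject₁ (f a)))
                    (isCycleMin-sound g-inj min 1)))

countᵇ-tabulate : ∀ {A : Set} {n} (P : A → Bool) (g : Fin n → A) → countᵇ P (L.tabulate g) ≡ count (P ∘ g)
countᵇ-tabulate {n = zero}  P g = refl
countᵇ-tabulate {n = suc n} P g with P (g Fin.zero)
... | true  = cong suc (countᵇ-tabulate P (g ∘ Fin.suc))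
... | false = countᵇ-tabulate P (g ∘ Fin.suc)

allᵇ-tabulate⁻ : ∀ {A : Set} {n} (P : A → Bool) (g : Fin n → A) →
                 allᵇ P (L.tabulate g) ≡ true → ∀ i → P (g i) ≡ true
allᵇ-tabulate⁻ {n = suc n} P g all≡true i with P (g Fin.zero) in P0
allᵇ-tabulate⁻ {n = suc n} P g all≡true Fin.zero    | true = P0
allᵇ-tabulate⁻ {n = suc n} P g all≡true (Fin.suc i) | true = allᵇ-tabulate⁻ P (g ∘ Fin.suc) all≡true i

allᵇ-tabulate-false : ∀ {A : Set} {n} (P : A → Bool) (g : Fin n → A) →
                      allᵇ P (L.tabulate g) ≡ false → ∃ λ i → P (g i) ≡ false
allᵇ-tabulate-false {n = suc n} P g all≡false with P (g Fin.zero) in P0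
... | false = Fin.zero , P0
... | true  with allᵇ-tabulate-false P (g ∘ Fin.suc) all≡false
...   | i , Pi≡false = Fin.suc i , Pi≡false

sumℚ-tabulate : ∀ {A : Set} {n} (h : A → ℚ) (g : Fin n → A) → sumℚ (L.map h (L.tabulate g)) ≡ sum (h ∘ g)
sumℚ-tabulate {n = zero}  h g = refl
sumℚ-tabulate {n = suc n} h g = cong (h (g Fin.zero) +_) (sumℚ-tabulate h (g ∘ Fin.suc))

exc≡excedances : ∀ {n} (π : Vec (Fin n) n) → exc π ≡ excedances (lookup π)
exc≡excedances π = countᵇ-tabulate (isExcedance (lookup π)) (λ i → i)

cyc≡cycles : ∀ {n} (π : Vec (Fin n) n) → cyc π ≡ cycles (lookup π)
cyc≡cycles {n} π = trans
  (countᵇ-tabulate (λ i → allᵇ (λ t → toℕ i ≤ᵇ toℕ (iter π (suc t) i)) (upTo n)) (λ i → i))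
  (count-cong (λ i →
  allᵇ-cong (λ t → cong (λ x → toℕ i ≤ᵇ toℕ x) (iter≡iterate (suc t) i)) (upTo n)))
  where
  iter≡iterate : ∀ t i → iter π t i ≡ iterate (lookup π) t i
  iter≡iterate zero    i = refl
  iter≡iterate (suc t) i = cong (lookup π) (iter≡iterate t i)

injᵇ⇒injective : ∀ {n} (π : Vec (Fin n) n) → injᵇ π ≡ true → Injective _≡_ _≡_ (lookup π)
injᵇ⇒injective {n} π checked {i} {j} πi≡πj
  with allᵇ-tabulate⁻ {n = n} _ (λ j → j) (allᵇ-tabulate⁻ {n = n} _ (λ i → i) checked i) j
... | i,j-checked with i Fin.≟ j
...   | yes i≡j = i≡j
...   | no  _ with lookup π i Fin.≟ lookup π j
...     | yes _     = case i,j-checked of λ ()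
...     | no  πi≢πj = ⊥-elim (πi≢πj πi≡πj)

injective⇒injᵇ : ∀ {n} (π : Vec (Fin n) n) → Injective _≡_ _≡_ (lookup π) → injᵇ π ≡ true
injective⇒injᵇ {n} π π-inj with injᵇ π in unchecked
... | true  = refl
... | false with allᵇ-tabulate-false {n = n} _ (λ i → i) unchecked
...   | i , row-false with allᵇ-tabulate-false {n = n} _ (λ j → j) row-false
...     | j , entry-false with i Fin.≟ j
...       | yes _   = case entry-false of λ ()
...       | no  i≢j with lookup π i Fin.≟ lookup π j
...         | yes πi≡πj = ⊥-elim (i≢j (π-inj πi≡πj))
...         | no  _     = case entry-false of λ ()

concatMap≡cartesianProductWith : ∀ {A B C : Set} (h : A → B → C) xs ys →
  L.concatMap (λ a → L.map (h a) ys) xs ≡ L.cartesianProductWith h xs ys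
concatMap≡cartesianProductWith h []       ys = refl
concatMap≡cartesianProductWith h (x ∷ xs) ys = cong (L.map (h x) ys L.++_) (concatMap≡cartesianProductWith h xs ys)

∈-words : ∀ n k (v : Vec (Fin n) k) → v ∈ words n k
∈-words n zero    V.[]       = here refl
∈-words n (suc k) (a V.∷ v) =
  subst ((a V.∷ v) ∈_) (sym (concatMap≡cartesianProductWith V._∷_ (L.allFin n) (words n k)))
  (∈-cartesianProductWith⁺ V._∷_ (∈-allFin a) (∈-words n k v))

unique-words : ∀ n k → Unique (words n k)
unique-words n zero    = All.[] ∷ []
unique-words n (suc k) = subst Unique (sym (concatMap≡cartesianProductWith V._∷_ (L.allFin n) (words n k)))
  (UniqueP.cartesianProductWith⁺ V._∷_ VP.∷-injective (UniqueP.allFin⁺ n) (unique-words n k))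

unique-𝔖 : ∀ n → Unique (𝔖 n)
unique-𝔖 n = UniqueP.filter⁺ (λ π → injᵇ π BoolP.≟ true) (unique-words n n)

∈𝔖⇒injective : ∀ {n} {π : Vec (Fin n) n} → π ∈ 𝔖 n → Injective _≡_ _≡_ (lookup π)
∈𝔖⇒injective {n} {π} π∈𝔖 =
  injᵇ⇒injective π (proj₂ (∈-filter⁻ (λ π → injᵇ π BoolP.≟ true) {xs = words n n} π∈𝔖))

injective⇒∈𝔖 : ∀ {n} {π : Vec (Fin n) n} → Injective _≡_ _≡_ (lookup π) → π ∈ 𝔖 n
injective⇒∈𝔖 {n} {π} π-inj =
  ∈-filter⁺ (λ π → injᵇ π BoolP.≟ true) (∈-words n n π) (injective⇒injᵇ π π-inj)

lookup-injective : ∀ {A : Set} {n} {u v : Vec A n} → lookup u ≗ lookup v → u ≡ v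
lookup-injective {u = u} {v} u≗v =
  trans (sym (VP.tabulate∘lookup u)) (trans (VP.tabulate-cong u≗v) (VP.tabulate∘lookup v))

insertTopᵛ : ∀ {n} → Vec (Fin n) n → Fin (suc n) → Vec (Fin (suc n)) (suc n)
insertTopᵛ π ch = V.tabulate (insertTop (lookup π) ch)

lookup-insertTopᵛ : ∀ {n} (π : Vec (Fin n) n) ch → lookup (insertTopᵛ π ch) ≗ insertTop (lookup π) ch
lookup-insertTopᵛ π ch = VP.lookup∘tabulate (insertTop (lookup π) ch)

insertions : ∀ n → List (Vec (Fin (suc n)) (suc n))
insertions n = L.cartesianProductWith insertTopᵛ (𝔖 n) (L.allFin (suc n))

insertTopᵛ-injective₂ : ∀ {n} {π π′ : Vec (Fin n) n} {ch ch′} →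
                        insertTopᵛ π ch ≡ insertTopᵛ π′ ch′ → π ≡ π′ × ch ≡ ch′
insertTopᵛ-injective₂ {π = π} {π′} {ch} {ch′} eq
  with insertTop-injective₂ ch ch′ (λ x → trans (sym (lookup-insertTopᵛ π ch x))
                                     (trans (cong (λ v → lookup v x) eq) (lookup-insertTopᵛ π′ ch′ x)))
... | π≗π′ , ch≡ch′ = lookup-injective π≗π′ , ch≡ch′

insertions⊆𝔖 : ∀ n {σ} → σ ∈ insertions n → σ ∈ 𝔖 (suc n)
insertions⊆𝔖 n σ∈ with ∈-cartesianProductWith⁻ insertTopᵛ (𝔖 n) (L.allFin (suc n)) σ∈
... | π , ch , π∈𝔖 , _ , refl = injective⇒∈𝔖 (λ {x} {y} eq → insertTop-injective (∈𝔖⇒injective π∈𝔖) ch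
        (trans (sym (lookup-insertTopᵛ π ch x)) (trans eq (lookup-insertTopᵛ π ch y))))

𝔖⊆insertions : ∀ n {σ} → σ ∈ 𝔖 (suc n) → σ ∈ insertions n
𝔖⊆insertions n {σ} σ∈𝔖 with preimage-fromℕ (∈𝔖⇒injective σ∈𝔖)
... | ch , σch≡top = subst (_∈ insertions n) π↦σ
      (∈-cartesianProductWith⁺ insertTopᵛ (injective⇒∈𝔖 {π = π} π-inj) (∈-allFin ch))
  where
  σ-inj : Injective _≡_ _≡_ (lookup σ)
  σ-inj = ∈𝔖⇒injective σ∈𝔖
  π : Vec (Fin n) n
  π = V.tabulate (removeTop σ-inj ch σch≡top)
  insert≗σ : insertTop (lookup π) ch ≗ lookup σ
  insert≗σ x = trans (insertTop-cong (VP.lookup∘tabulate _) ch x) (insertTop-removeTop σ-inj ch σch≡top x)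
  π-inj : Injective _≡_ _≡_ (lookup π)
  π-inj = insertTop-injective⁻ ch (λ {x} {y} eq → σ-inj (trans (sym (insert≗σ x)) (trans eq (insert≗σ y))))
  π↦σ : insertTopᵛ π ch ≡ σ
  π↦σ = lookup-injective (λ x → trans (lookup-insertTopᵛ π ch x) (insert≗σ x))

insertions↭𝔖 : ∀ n → insertions n ↭ 𝔖 (suc n)
insertions↭𝔖 n = ∼bag⇒↭ (unique∧set⇒bag
  (UniqueP.cartesianProductWith⁺ insertTopᵛ insertTopᵛ-injective₂ (unique-𝔖 n) (UniqueP.allFin⁺ (suc n)))
  (unique-𝔖 (suc n)) (mk⇔ (insertions⊆𝔖 n) (𝔖⊆insertions n)))

sumℚ-↭ : ∀ {xs ys : List ℚ} → xs ↭ ys → sumℚ xs ≡ sumℚ ys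
sumℚ-↭ xs↭ys = foldr-commMonoid (setoid ℚ) ℚP.+-0-isCommutativeMonoid (↭⇒↭ₛ xs↭ys)

sumℚ-++ : ∀ (xs ys : List ℚ) → sumℚ (xs L.++ ys) ≡ sumℚ xs + sumℚ ys
sumℚ-++ []       ys = sym (ℚP.+-identityˡ _)
sumℚ-++ (x ∷ xs) ys = trans (cong (x +_) (sumℚ-++ xs ys)) (sym (ℚP.+-assoc x _ _))

sumℚ-cartesianProductWith : ∀ {A B C : Set} (w : C → ℚ) (h : A → B → C) xs ys →
  sumℚ (L.map w (L.cartesianProductWith h xs ys)) ≡ sumℚ (L.map (λ x → sumℚ (L.map (λ y → w (h x y)) ys)) xs)
sumℚ-cartesianProductWith w h []       ys = refl
sumℚ-cartesianProductWith w h (x ∷ xs) ys = begin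
    sumℚ (L.map w (L.map (h x) ys L.++ L.cartesianProductWith h xs ys))
  ≡⟨ cong sumℚ (LP.map-++ w (L.map (h x) ys) _) ⟩
    sumℚ (L.map w (L.map (h x) ys) L.++ L.map w (L.cartesianProductWith h xs ys))
  ≡⟨ sumℚ-++ (L.map w (L.map (h x) ys)) _ ⟩
    sumℚ (L.map w (L.map (h x) ys)) + sumℚ (L.map w (L.cartesianProductWith h xs ys))
  ≡⟨ cong₂ _+_ (cong sumℚ (sym (LP.map-∘ ys))) (sumℚ-cartesianProductWith w h xs ys) ⟩
    sumℚ (L.map (λ y → w (h x y)) ys) + sumℚ (L.map (λ x → sumℚ (L.map (λ y → w (h x y)) ys)) xs)
  ∎
  where open ≡-Reasoning

eulerianStep-sumℚ : ∀ n y {A : Set} (g : A → Poly) xs →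
  eulerianStep n y (λ j → sumℚ (L.map (λ x → g x j) xs))
  ≗ (λ j → sumℚ (L.map (λ x → eulerianStep n y (g x) j) xs))
eulerianStep-sumℚ n y g []       zero    = ℚP.*-zeroʳ y
eulerianStep-sumℚ n y g []       (suc j) =
  solve 2 (λ a b → a :* con 0ℚ :+ b :* con 0ℚ := con 0ℚ) refl (y + ℕ→ℚ (suc j)) (ℕ→ℚ n - ℕ→ℚ j)
eulerianStep-sumℚ n y g (x ∷ xs) zero    = trans (ℚP.*-distribˡ-+ y (g x 0) _)
  (cong (y * g x 0 +_) (eulerianStep-sumℚ n y g xs 0))
eulerianStep-sumℚ n y g (x ∷ xs) (suc j) = trans
  (solve 6 (λ a b u v s t → a :* (u :+ s) :+ b :* (v :+ t) := (a :* u :+ b :* v) :+ (a :* s :+ b :* t)) refl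
     (y + ℕ→ℚ (suc j)) (ℕ→ℚ n - ℕ→ℚ j) (g x (suc j)) (g x j)
     (sumℚ (L.map (λ x → g x (suc j)) xs)) (sumℚ (L.map (λ x → g x j) xs)))
  (cong (eulerianStep n y (g x) (suc j) +_) (eulerianStep-sumℚ n y g xs (suc j)))

-- The recurrence of the Eulerian polynomials

monomial : ℚ → ℕ → ℕ → Poly
monomial y e c j = if ⌊ e ℕ.≟ j ⌋ then y ^ℚ c else 0ℚ

module _ (y : ℚ) (e c : ℕ) where

  euler-monomial : ∀ j → ℕ→ℚ j * monomial y e c j ≡ ℕ→ℚ e * monomial y e c j
  euler-monomial j with e ℕ.≟ j
  ... | yes refl = refl
  ... | no  _    = trans (ℚP.*-zeroʳ (ℕ→ℚ j)) (sym (ℚP.*-zeroʳ (ℕ→ℚ e)))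

  timesX-monomial : timesX (monomial y e c) ≗ monomial y (suc e) c
  timesX-monomial zero    = refl
  timesX-monomial (suc j) with e ℕ.≟ j | suc e ℕ.≟ suc j
  ... | yes _   | yes _     = refl
  ... | no  _   | no  _     = refl
  ... | yes e≡j | no  e+1≢j = ⊥-elim (e+1≢j (cong suc e≡j))
  ... | no  e≢j | yes e+1≡j = ⊥-elim (e≢j (ℕP.suc-injective e+1≡j))

  monomial-suc : ∀ j → monomial y e (suc c) j ≡ y * monomial y e c j
  monomial-suc j with e ℕ.≟ j
  ... | yes _ = refl
  ... | no  _ = sym (ℚP.*-zeroʳ y)

  -- Of the n + 1 insertions into a permutation with monomial yᶜ xᵉ, e keep it, n − e multiply it by x, one by y.
  monomial-step : ∀ n → e ≤ n → ∀ j →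
    ℕ→ℚ e * monomial y e c j + ℕ→ℚ (n ∸ e) * monomial y (suc e) c j + monomial y e (suc c) j
    ≡ eulerianStep n y (monomial y e c) j
  monomial-step n e≤n zero = begin
      ℕ→ℚ e * M 0 + ℕ→ℚ (n ∸ e) * 0ℚ + monomial y e (suc c) 0
    ≡⟨ cong₂ (λ s t → s + ℕ→ℚ (n ∸ e) * 0ℚ + t) (sym (euler-monomial 0)) (monomial-suc 0) ⟩
      0ℚ * M 0 + ℕ→ℚ (n ∸ e) * 0ℚ + y * M 0
    ≡⟨ solve 3 (λ a b m → con 0ℚ :* m :+ a :* con 0ℚ :+ b :* m := b :* m) refl (ℕ→ℚ (n ∸ e)) y (M 0) ⟩
      y * M 0
    ∎
    where
    open ≡-Reasoning
    M : Poly
    M = monomial y e c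
  monomial-step n e≤n (suc j) = begin
      ℕ→ℚ e * M (suc j) + ℕ→ℚ (n ∸ e) * monomial y (suc e) c (suc j) + monomial y e (suc c) (suc j)
    ≡⟨ cong₂ (λ s t → s + t + monomial y e (suc c) (suc j))
             (sym (euler-monomial (suc j))) (cong₂ _*_ (ℕ→ℚ-∸ e≤n) (sym (timesX-monomial (suc j)))) ⟩
      ℕ→ℚ (suc j) * M (suc j) + (ℕ→ℚ n - ℕ→ℚ e) * M j + monomial y e (suc c) (suc j)
    ≡⟨ cong₂ (λ s t → ℕ→ℚ (suc j) * M (suc j) + s + t)
             (trans (solve 3 (λ a b m → (a :- b) :* m := a :* m :- b :* m) refl (ℕ→ℚ n) (ℕ→ℚ e) (M j))
                    (cong (ℕ→ℚ n * M j -_) (sym (euler-monomial j))))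
             (monomial-suc (suc j)) ⟩
      ℕ→ℚ (suc j) * M (suc j) + (ℕ→ℚ n * M j - ℕ→ℚ j * M j) + y * M (suc j)
    ≡⟨ solve 6 (λ s n j y m m′ → s :* m′ :+ (n :* m :- j :* m) :+ y :* m′ := (y :+ s) :* m′ :+ (n :- j) :* m)
         refl (ℕ→ℚ (suc j)) (ℕ→ℚ n) (ℕ→ℚ j) y (M j) (M (suc j)) ⟩
      eulerianStep n y M (suc j)
    ∎
    where
    open ≡-Reasoning
    M : Poly
    M = monomial y e c

module _ {n} {f : Fin n → Fin n} (f-inj : Injective _≡_ _≡_ f) (y : ℚ) where

  insertions-monomial : ∀ j →
    sum (λ ch → monomial y (excedances (insertTop f ch)) (cycles (insertTop f ch)) j)
    ≡ eulerianStep n y (monomial y (excedances f) (cycles f)) j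
  insertions-monomial j = begin
      sum w
    ≡⟨ sum-init-last w ⟩
      sum (w ∘ inject₁) + w (fromℕ n)
    ≡⟨ cong₂ _+_ (trans (sum-cong-≗ after) (sum-if P (M e c) (M (suc e) c))) fixed ⟩
      ℕ→ℚ e * M e c + ℕ→ℚ (count (not ∘ P)) * M (suc e) c + M e (suc c)
    ≡⟨ cong (λ k → ℕ→ℚ e * M e c + ℕ→ℚ k * M (suc e) c + M e (suc c)) non-excedances ⟩
      ℕ→ℚ e * M e c + ℕ→ℚ (n ∸ e) * M (suc e) c + M e (suc c)
    ≡⟨ monomial-step y e c n (count≤n P) j ⟩
      eulerianStep n y (monomial y e c) j
    ∎
    where
    open ≡-Reasoning
    P : Fin n → Bool
    P = isExcedance f
    e c : ℕ
    e = excedances f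
    c = cycles f
    M : ℕ → ℕ → ℚ
    M e c = monomial y e c j
    w : Fin (suc n) → ℚ
    w ch = M (excedances (insertTop f ch)) (cycles (insertTop f ch))
    after : ∀ a → w (inject₁ a) ≡ (if P a then M e c else M (suc e) c)
    after a rewrite excedances-after f a | cycles-after f-inj a with P a
    ... | true  = cong (λ k → M k c) (ℕP.+-identityʳ e)
    ... | false = cong (λ k → M k c) (ℕP.+-comm e 1)
    fixed : w (fromℕ n) ≡ M e (suc c)
    fixed = cong₂ M (excedances-fix f) (cycles-fix f-inj)
    non-excedances : count (not ∘ P) ≡ n ∸ e
    non-excedances = sym (trans (cong (_∸ e) (sym (count-+-count-not P))) (ℕP.m+n∸m≡n e _))

eulerian : ℚ → ℕ → Poly
eulerian y n j = sumℚ (L.map (λ π → monomial y (exc π) (cyc π) j) (𝔖 n))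

eulerian-suc : ∀ y n → eulerian y (suc n) ≗ eulerianStep n y (eulerian y n)
eulerian-suc y n j = begin
    eulerian y (suc n) j
  ≡⟨ sumℚ-↭ (PermP.map⁺ w (insertions↭𝔖 n)) ⟨
    sumℚ (L.map w (insertions n))
  ≡⟨ sumℚ-cartesianProductWith w insertTopᵛ (𝔖 n) (L.allFin (suc n)) ⟩
    sumℚ (L.map (λ π → sumℚ (L.map (λ ch → w (insertTopᵛ π ch)) (L.allFin (suc n)))) (𝔖 n))
  ≡⟨ cong sumℚ (LP.map-cong-local (All.tabulate insertions-of)) ⟩
    sumℚ (L.map (λ π → eulerianStep n y (monomialᵛ π) j) (𝔖 n))
  ≡⟨ eulerianStep-sumℚ n y monomialᵛ (𝔖 n) j ⟨
    eulerianStep n y (eulerian y n) j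
  ∎
  where
  open ≡-Reasoning
  monomialᵛ : ∀ {m} → Vec (Fin m) m → Poly
  monomialᵛ σ = monomial y (exc σ) (cyc σ)
  w : Vec (Fin (suc n)) (suc n) → ℚ
  w σ = monomialᵛ σ j
  monomialᵛ≗ : ∀ {m} (σ : Vec (Fin m) m) →
               monomialᵛ σ ≗ monomial y (excedances (lookup σ)) (cycles (lookup σ))
  monomialᵛ≗ σ k = cong₂ (λ e c → monomial y e c k) (exc≡excedances σ) (cyc≡cycles σ)
  insertions-of : ∀ {π} → π ∈ 𝔖 n →
    sumℚ (L.map (λ ch → w (insertTopᵛ π ch)) (L.allFin (suc n))) ≡ eulerianStep n y (monomialᵛ π) j
  insertions-of {π} π∈𝔖 = begin
      sumℚ (L.map (λ ch → w (insertTopᵛ π ch)) (L.allFin (suc n)))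
    ≡⟨ sumℚ-tabulate (λ ch → w (insertTopᵛ π ch)) (λ ch → ch) ⟩
      sum (λ ch → w (insertTopᵛ π ch))
    ≡⟨ sum-cong-≗ (λ ch → trans (monomialᵛ≗ (insertTopᵛ π ch) j)
         (cong₂ (λ e c → monomial y e c j) (excedances-cong (lookup-insertTopᵛ π ch))
                                           (cycles-cong (lookup-insertTopᵛ π ch)))) ⟩
      sum (λ ch → monomial y (excedances (insertTop (lookup π) ch)) (cycles (insertTop (lookup π) ch)) j)
    ≡⟨ insertions-monomial (∈𝔖⇒injective π∈𝔖) y j ⟩
      eulerianStep n y (monomial y (excedances (lookup π)) (cycles (lookup π))) j
    ≡⟨ eulerianStep-cong (monomialᵛ≗ π) j ⟨
      eulerianStep n y (monomialᵛ π) j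
    ∎

Fat≗eulerian : ∀ y n → Fat n y ≗ eulerian y n
Fat≗eulerian y zero    zero    = refl
Fat≗eulerian y zero    (suc j) = refl
Fat≗eulerian y (suc n) j       = refl

Fat-eulerianRecurrence : ∀ y → EulerianRecurrence y (λ n → Fat n y)
Fat-eulerianRecurrence y = record
  { initial = λ _ → refl
  ; step    = λ n j → trans (Fat≗eulerian y (suc n) j)
                     (trans (eulerian-suc y n j) (eulerianStep-cong (λ k → sym (Fat≗eulerian y n k)) j))
  }

mainTheorem8 : (n j : ℕ) → p n j ≡ rhs n j
mainTheorem8 n j = begin
    p n j                   ≡⟨ p≗binomialConvolution n j ⟩
    binomialConvolution n j ≡⟨ binomialConvolution≗rhs (qq≗2^m*F (Fat-eulerianRecurrence ½)) n j ⟩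
    rhs n j                 ∎
  where open ≡-Reasoning
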